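{- For every integer $k\ge 2$ and every graph $G$: (i) if $G$ is uniformly $k$-connected, then $G$ is super-minimally $k$-connected; and (ii) if $G$ is super-minimally $k$-connected, then $G$ is minimally $k$-connected. Moreover, for every $k\ge 3$, neither converse holds: there is a super-minimally $k$-connected graph that is not uniformly $k$-connected, and there is a minimally $k$-connected graph that is not super-minimally $k$-connected.
   Context: All graphs are finite and simple. A graph is $k$-connected if it has more than $k$ vertices and no vertex cut of size less than $k$. $G$ is minimally $k$-connected if it is $k$-connected but $G\setminus e$ is not $k$-connected for every edge $e$. $G$ is super-minimally $k$-connected if it is $k$-connected but no proper subgraph of $G$ is $k$-connected. $G$ is uniformly $k$-connected if for every pair of distinct vertices there are exactly $k$ internally disjoint paths connecting them. -}

module Defs where

open import Data.Nat using (ℕ; suc; _<_)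
open import Data.Bool using (Bool; true; false; _∧_; _∨_; not)
open import Data.Bool.Properties using (∧-comm; ∨-comm)
open import Data.Fin using (Fin; _≟_)
open import Data.Fin.Subset using (Subset; _∈_; _∉_; ∣_∣)
open import Data.List using (List; []; _∷_; _++_)
open import Data.List.Relation.Unary.All using (All)
open import Data.List.Relation.Unary.Linked using (Linked)
open import Data.List.Relation.Unary.Unique.Propositional using (Unique)
import Data.List.Membership.Propositional as LM
open import Data.Product using (Σ; ∃; _×_; _,_)
open import Function.Definitions using (Injective; Surjective)
open import Relation.Nullary using (¬_; does)
open import Relation.Binary.PropositionalEquality using (_≡_; _≢_; refl; cong; cong₂; trans)

record Graph (n : ℕ) : Set where
  field
    adj     : Fin n → Fin n → Bool
    adj-sym : ∀ i j → adj i j ≡ adj j i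
    adj-irr : ∀ i → adj i i ≡ false
open Graph public

Adj : ∀ {n} → Graph n → Fin n → Fin n → Set
Adj G i j = adj G i j ≡ true

-- u-v path given by its list of interior vertices xs:
-- the vertex sequence u , xs , v is a walk with no repeated vertex.
IsPath : ∀ {n} → Graph n → Fin n → Fin n → List (Fin n) → Set
IsPath G u v xs = Linked (Adj G) (u ∷ xs ++ v ∷ []) × Unique (u ∷ xs ++ v ∷ [])

PathAvoiding : ∀ {n} → Graph n → Subset n → Fin n → Fin n → Set
PathAvoiding G S u v = ∃ λ xs → IsPath G u v xs × All (λ x → x ∉ S) xs

KConnected : ℕ → ∀ {n} → Graph n → Set
KConnected k {n} G =
  k < n ×
  (∀ (S : Subset n) → ∣ S ∣ < k →
     ∀ u v → u ∉ S → v ∉ S → u ≢ v → PathAvoiding G S u v)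

HasDisjointPaths : ∀ {n} → Graph n → ℕ → Fin n → Fin n → Set
HasDisjointPaths {n} G m u v =
  Σ (Fin m → List (Fin n)) λ P →
    (∀ i → IsPath G u v (P i)) ×
    (∀ i j → i ≢ j →
       P i ≢ P j × (∀ x → x LM.∈ P i → ¬ (x LM.∈ P j)))

UniformlyKConnected : ℕ → ∀ {n} → Graph n → Set
UniformlyKConnected k {n} G =
  KConnected k G ×
  (∀ (u v : Fin n) → u ≢ v →
     HasDisjointPaths G k u v × ¬ HasDisjointPaths G (suc k) u v)

private
  eqb : ∀ {n} → Fin n → Fin n → Bool
  eqb i j = does (i ≟ j)

  hit : ∀ {n} → Fin n → Fin n → Fin n → Fin n → Bool
  hit u v i j = (eqb i u ∧ eqb j v) ∨ (eqb i v ∧ eqb j u)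

  hit-sym : ∀ {n} (u v i j : Fin n) → hit u v i j ≡ hit u v j i
  hit-sym u v i j =
    trans (∨-comm (eqb i u ∧ eqb j v) (eqb i v ∧ eqb j u))
          (cong₂ _∨_ (∧-comm (eqb i v) (eqb j u)) (∧-comm (eqb i u) (eqb j v)))

deleteEdge : ∀ {n} → Graph n → Fin n → Fin n → Graph n
deleteEdge G u v = record
  { adj     = λ i j → adj G i j ∧ not (hit u v i j)
  ; adj-sym = λ i j → cong₂ _∧_ (adj-sym G i j) (cong not (hit-sym u v i j))
  ; adj-irr = λ i → cong (_∧ not (hit u v i i)) (adj-irr G i)
  }

MinimallyKConnected : ℕ → ∀ {n} → Graph n → Set
MinimallyKConnected k G =
  KConnected k G × (∀ u v → Adj G u v → ¬ KConnected k (deleteEdge G u v))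

record Subgraph {n : ℕ} (G : Graph n) : Set where
  field
    m       : ℕ
    H       : Graph m
    f       : Fin m → Fin n
    f-inj   : Injective _≡_ _≡_ f
    f-edges : ∀ i j → Adj H i j → Adj G (f i) (f j)
open Subgraph public

Proper : ∀ {n} {G : Graph n} → Subgraph G → Set
Proper {G = G} S =
  ¬ (Surjective _≡_ _≡_ (f S) × (∀ i j → Adj G (f S i) (f S j) → Adj (H S) i j))

SuperMinimallyKConnected : ℕ → ∀ {n} → Graph n → Set
SuperMinimallyKConnected k G =
  KConnected k G × (∀ (S : Subgraph G) → Proper S → ¬ KConnected k (H S))

{-# OPTIONS --safe #-}
-- Let H be a proper k-connected subgraph of a uniformly k-connected graph G.  By Menger's theorem any two
-- vertices of H are joined by k internally disjoint paths of H.  If H misses an edge ab of G, that edge is a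
-- (k+1)-st path from a to b; if H misses a vertex, the 2-connectivity of G yields an ear through it, a path of
-- length at least two between vertices of H with no inner vertex in H, which again is a (k+1)-st path.  Either way
-- G is not uniformly k-connected.  A super-minimally k-connected graph is minimally k-connected since deleting
-- an edge gives a proper subgraph.
--
-- For k ≥ 3, K(k, k+1) is minimally k-connected, as every edge meets a vertex of degree k, but contains K(k, k).
-- In the double star below every edge also meets a vertex of degree k; such vertices keep all their neighbours
-- in any k-connected subgraph, which therefore is everything.  Yet two of its vertices have k + 1 common
-- neighbours.
module Submission where

open import Defs
open import Data.Nat using (ℕ; zero; suc; _≤_; _<_; z≤n; s≤s; _+_)
open import Data.Nat.Properties
open import Data.Bool using (Bool; true; false; _∧_; _∨_)
open import Data.Bool.Properties using (∧-conicalˡ; ∧-zeroʳ; ∨-comm) renaming (_≟_ to _≟ᵇ_)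
open import Data.Unit using (⊤; tt)
open import Data.Fin using (Fin; zero; suc; fromℕ<; inject₁; fromℕ) renaming (_≟_ to _≟ᶠ_)
open import Data.Fin.Properties using (any?; +↔⊎; inject₁-injective; fromℕ≢inject₁)
import Data.Fin.Properties as Fin
open import Data.Fin.Subset as Sub
  using (Subset; ∣_∣; ⁅_⁆; _∪_; _─_; _-_; _⊆_; inside; outside) renaming (_∈_ to _∈ₛ_; _∉_ to _∉ₛ_; ⊥ to ∅)
open import Data.Fin.Subset.Properties as SubP using (_∈?_)
open import Data.Vec as Vec using ([]; _∷_)
open import Data.Vec.Properties using (lookup∘tabulate; []=⇒lookup; lookup⇒[]=)
open import Data.Vec.Functional using () renaming (_∷_ to _∷ᵛ_)
open import Data.List using (List; []; _∷_; _++_; length; tabulate; map; filter; allFin)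
open import Data.List.Properties using (length-tabulate; length-map; map-++; map-injective; ∷-injectiveˡ)
open import Data.List.Relation.Unary.All as All using (All; []; _∷_)
open import Data.List.Relation.Unary.All.Properties as Allₚ using (¬Any⇒All¬)
open import Data.List.Relation.Unary.Any as Any using (here; there)
open import Data.List.Relation.Unary.Linked as Linked using (Linked; []; [-]; _∷_)
import Data.List.Relation.Unary.Linked.Properties as Linkedₚ
open import Data.List.Relation.Unary.Unique.Propositional using (Unique; []; _∷_)
import Data.List.Relation.Unary.Unique.Propositional.Properties as Unique
open import Data.List.Relation.Binary.Disjoint.Propositional using (Disjoint)
import Data.List.Relation.Binary.Disjoint.Propositional.Properties as Disjointₚ
open import Data.List.Membership.Propositional using (_∈_; _∉_; find)
open import Data.List.Membership.Propositional.Properties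
  using (∈-++⁺ˡ; ∈-++⁺ʳ; ∈-++⁻; ∈-tabulate⁺; ∈-map⁺; ∈-map⁻; ∈-filter⁺; ∈-filter⁻; ∈-allFin)
import Data.List.Membership.DecPropositional as DecMembership
open import Data.Product using (Σ; ∃; _×_; _,_; proj₁; proj₂)
open import Data.Sum using (_⊎_; inj₁; inj₂; [_,_]′)
import Data.Sum as Sum
open import Data.Sum.Properties using (inj₁-injective; inj₂-injective)
open import Data.Sum.Function.Propositional using (_⊎-↔_)
open import Data.Empty using (⊥; ⊥-elim)
open import Function using (_∘_; id; _↔_)
open import Function.Bundles using (Inverse)
open import Function.Definitions using (Surjective)
open import Function.Properties.Inverse using (↔-sym; ↔-trans; ↔-refl)
open import Relation.Nullary using (¬_; ¬?; Dec; yes; no; does)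
open import Relation.Nullary.Decidable using (dec-true; decidable-stable)
open import Relation.Unary using (Decidable)
open import Relation.Binary.PropositionalEquality using (_≡_; _≢_; refl; sym; trans; cong; cong₂; subst; subst₂)

private variable
  n k q : ℕ

∣p∪q∣≤∣p∣+∣q∣ : ∀ (p q : Subset n) → ∣ p ∪ q ∣ ≤ ∣ p ∣ + ∣ q ∣
∣p∪q∣≤∣p∣+∣q∣ []            []            = z≤n
∣p∪q∣≤∣p∣+∣q∣ (inside ∷ p)  (inside ∷ q)  =
  s≤s (≤-trans (∣p∪q∣≤∣p∣+∣q∣ p q) (+-monoʳ-≤ ∣ p ∣ (n≤1+n ∣ q ∣)))
∣p∪q∣≤∣p∣+∣q∣ (inside ∷ p)  (outside ∷ q) = s≤s (∣p∪q∣≤∣p∣+∣q∣ p q)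
∣p∪q∣≤∣p∣+∣q∣ (outside ∷ p) (inside ∷ q)  =
  subst (suc ∣ p ∪ q ∣ ≤_) (sym (+-suc ∣ p ∣ ∣ q ∣)) (s≤s (∣p∪q∣≤∣p∣+∣q∣ p q))
∣p∪q∣≤∣p∣+∣q∣ (outside ∷ p) (outside ∷ q) = ∣p∪q∣≤∣p∣+∣q∣ p q

∣p∪⁅x⁆∣≤1+∣p∣ : ∀ (p : Subset n) x → ∣ p ∪ ⁅ x ⁆ ∣ ≤ suc ∣ p ∣
∣p∪⁅x⁆∣≤1+∣p∣ p x =
  subst (∣ p ∪ ⁅ x ⁆ ∣ ≤_) (trans (cong (∣ p ∣ +_) (SubP.∣⁅x⁆∣≡1 x)) (+-comm ∣ p ∣ 1)) (∣p∪q∣≤∣p∣+∣q∣ p ⁅ x ⁆)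

∣p∣<n⇒∣p∪⁅x⁆∣<1+n : ∀ {k} (p : Subset n) x → ∣ p ∣ < k → ∣ p ∪ ⁅ x ⁆ ∣ < suc k
∣p∣<n⇒∣p∪⁅x⁆∣<1+n p x ∣p∣<k = ≤-<-trans (∣p∪⁅x⁆∣≤1+∣p∣ p x) (s≤s ∣p∣<k)

x∈p∪⁅x⁆ : ∀ (p : Subset n) x → x ∈ₛ p ∪ ⁅ x ⁆
x∈p∪⁅x⁆ p x = SubP.x∈p∪q⁺ (inj₂ (SubP.x∈⁅x⁆ x))

x∉p∪⁅y⁆ : ∀ {p : Subset n} {x y} → x ∉ₛ p → x ≢ y → x ∉ₛ p ∪ ⁅ y ⁆
x∉p∪⁅y⁆ {p = p} {y = y} x∉p x≢y x∈ with SubP.x∈p∪q⁻ p ⁅ y ⁆ x∈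
... | inj₁ x∈p  = x∉p x∈p
... | inj₂ x∈⁅y⁆ = x≢y (SubP.x∈⁅y⁆⇒x≡y y x∈⁅y⁆)

x∈p─q⇒x∉q : ∀ {p q : Subset n} {x} → x ∈ₛ p Sub.─ q → x ∉ₛ q
x∈p─q⇒x∉q {p = _ ∷ p} {outside ∷ q} {zero}  _            ()
x∈p─q⇒x∉q {p = _ ∷ p} {inside ∷ q}  {zero}  ()
x∈p─q⇒x∉q {p = _ ∷ p} {_ ∷ q}       {suc x} (Vec.there x∈) (Vec.there x∈q) = x∈p─q⇒x∉q x∈ x∈q

x∉p∪⁅y⁆⁻ : ∀ {p : Subset n} {x y} → x ∉ₛ p ∪ ⁅ y ⁆ → x ∉ₛ p × x ≢ y
x∉p∪⁅y⁆⁻ {p = p} {y = y} x∉ =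
  (λ x∈p → x∉ (SubP.x∈p∪q⁺ (inj₁ x∈p))) , λ { refl → x∉ (x∈p∪⁅x⁆ p y) }

setOf : List (Fin n) → Subset n
setOf []       = ∅
setOf (x ∷ xs) = ⁅ x ⁆ ∪ setOf xs

∈-setOf⁺ : ∀ {xs : List (Fin n)} {x} → x ∈ xs → x ∈ₛ setOf xs
∈-setOf⁺ (here refl) = SubP.x∈p∪q⁺ (inj₁ (SubP.x∈⁅x⁆ _))
∈-setOf⁺ (there x∈)  = SubP.x∈p∪q⁺ (inj₂ (∈-setOf⁺ x∈))

∈-setOf⁻ : ∀ (xs : List (Fin n)) {x} → x ∈ₛ setOf xs → x ∈ xs
∈-setOf⁻ []       x∈ = ⊥-elim (SubP.∉⊥ x∈)
∈-setOf⁻ (y ∷ xs) x∈ with SubP.x∈p∪q⁻ ⁅ y ⁆ (setOf xs) x∈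
... | inj₁ x∈⁅y⁆ = here (SubP.x∈⁅y⁆⇒x≡y y x∈⁅y⁆)
... | inj₂ x∈xs  = there (∈-setOf⁻ xs x∈xs)

∣setOf∣≤length : ∀ (xs : List (Fin n)) → ∣ setOf xs ∣ ≤ length xs
∣setOf∣≤length {n} []  = ≤-reflexive (SubP.∣⊥∣≡0 n)
∣setOf∣≤length (x ∷ xs) = ≤-trans (∣p∪q∣≤∣p∣+∣q∣ ⁅ x ⁆ (setOf xs))
  (≤-trans (≤-reflexive (cong (_+ ∣ setOf xs ∣) (SubP.∣⁅x⁆∣≡1 x))) (s≤s (∣setOf∣≤length xs)))

∣setOf-x∣<length : ∀ (xs : List (Fin n)) {x} → x ∈ xs → ∣ setOf xs - x ∣ < length xs
∣setOf-x∣<length xs x∈ = <-≤-trans (SubP.x∈p⇒∣p-x∣<∣p∣ (∈-setOf⁺ x∈)) (∣setOf∣≤length xs)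

length≤∣p∣ : ∀ (p : Subset n) {xs} → Unique xs → All (_∈ₛ p) xs → length xs ≤ ∣ p ∣
length≤∣p∣ p []                   []           = z≤n
length≤∣p∣ p {x ∷ xs} (x∉xs ∷ xs!) (x∈p ∷ xs⊆p) =
  ≤-trans (s≤s (length≤∣p∣ (p - x) xs! (All.zipWith minus-x (x∉xs , xs⊆p)))) (SubP.x∈p⇒∣p-x∣<∣p∣ x∈p)
  where
  minus-x : ∀ {y} → x ≢ y × y ∈ₛ p → y ∈ₛ p - x
  minus-x (x≢y , y∈p) = SubP.x∈p∧x≢y⇒x∈p-y y∈p (x≢y ∘ sym)

∣preimage∣≤∣p∣ : ∀ {m} (φ : Fin m → Fin n) → (∀ {i j} → φ i ≡ φ j → i ≡ j) → (p : Subset n) →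
                 Σ (Subset m) λ T → ∣ T ∣ ≤ ∣ p ∣ × (∀ {j} → φ j ∈ₛ p → j ∈ₛ T)
∣preimage∣≤∣p∣ {m = m} φ φ-inj p =
  setOf js , ≤-trans (∣setOf∣≤length js) ∣js∣≤∣p∣ ,
  λ φj∈p → ∈-setOf⁺ (∈-filter⁺ φ∈p? (∈-allFin _) φj∈p)
  where
  φ∈p? : Decidable (λ j → φ j ∈ₛ p)
  φ∈p? j = φ j ∈? p
  js : List (Fin m)
  js = filter φ∈p? (allFin m)
  φ[js]⊆p : All (_∈ₛ p) (map φ js)
  φ[js]⊆p = All.tabulate λ φj∈ → let j , j∈js , φj≡ = ∈-map⁻ φ φj∈ in
    subst (_∈ₛ p) (sym φj≡) (proj₂ (∈-filter⁻ φ∈p? {xs = allFin m} j∈js))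
  ∣js∣≤∣p∣ : length js ≤ ∣ p ∣
  ∣js∣≤∣p∣ = subst (_≤ ∣ p ∣) (length-map φ js)
    (length≤∣p∣ p (Unique.map⁺ φ-inj (Unique.filter⁺ φ∈p? (Unique.allFin⁺ m))) φ[js]⊆p)

PairwiseDisjoint : {A : Set} → (Fin q → List A) → Set
PairwiseDisjoint R = ∀ i j → i ≢ j → Disjoint (R i) (R j)

disjoint-⊆ : ∀ {A : Set} {R R′ : Fin q → List A} → PairwiseDisjoint R → (∀ i {z} → z ∈ R′ i → z ∈ R i) →
             PairwiseDisjoint R′
disjoint-⊆ R# R′⊆R i j i≢j (z∈i , z∈j) = R# i j i≢j (R′⊆R i z∈i , R′⊆R j z∈j)

module _ {A X : Set} (f : A → List X) where

  disjoint-∷ : ∀ {a} {as : Fin q → A} → (∀ i → Disjoint (f a) (f (as i))) →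
               PairwiseDisjoint (f ∘ as) → PairwiseDisjoint (f ∘ (a ∷ᵛ as))
  disjoint-∷ a#as as# zero    zero    0≢0 = ⊥-elim (0≢0 refl)
  disjoint-∷ a#as as# zero    (suc j) _   = a#as j
  disjoint-∷ a#as as# (suc i) zero    _   = Disjointₚ.sym (a#as i)
  disjoint-∷ a#as as# (suc i) (suc j) i≢j = as# i j (i≢j ∘ cong suc)

select : ∀ {A : Set} (i₀ : Fin q) → A → ((i : Fin q) → i ≢ i₀ → A) → Fin q → A
select i₀ a f i with i ≟ᶠ i₀
... | yes _    = a
... | no i≢i₀ = f i i≢i₀

module _ {A : Set} {i₀ : Fin q} {a : A} {f : (i : Fin q) → i ≢ i₀ → A} where

  select-at : select i₀ a f i₀ ≡ a
  select-at with i₀ ≟ᶠ i₀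
  ... | yes _     = refl
  ... | no i₀≢i₀ = ⊥-elim (i₀≢i₀ refl)

  select-elim : ∀ (P : Fin q → A → Set) → P i₀ a → (∀ i i≢i₀ → P i (f i i≢i₀)) → ∀ i → P i (select i₀ a f i)
  select-elim P Pa Pf i with i ≟ᶠ i₀
  ... | yes refl = Pa
  ... | no i≢i₀ = Pf i i≢i₀

  select-away : ∀ (P : Fin q → A → Set) → (∀ i i≢i₀ → P i (f i i≢i₀)) →
                ∀ {i} → i ≢ i₀ → P i (select i₀ a f i)
  select-away P Pf {i} i≢i₀ with i ≟ᶠ i₀
  ... | yes i≡i₀ = ⊥-elim (i≢i₀ i≡i₀)
  ... | no i≢i₀′ = Pf i i≢i₀′

  disjoint-select : ∀ {X : Set} (g : A → List X) →
                    (∀ i j i≢i₀ j≢i₀ → i ≢ j → Disjoint (g (f i i≢i₀)) (g (f j j≢i₀))) →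
                    (∀ i i≢i₀ → Disjoint (g a) (g (f i i≢i₀))) → PairwiseDisjoint (g ∘ select i₀ a f)
  disjoint-select g f# a#f i j i≢j with i ≟ᶠ i₀ | j ≟ᶠ i₀
  ... | yes refl | yes refl = ⊥-elim (i≢j refl)
  ... | yes _    | no j≢i₀ = a#f j j≢i₀
  ... | no i≢i₀ | yes _    = Disjointₚ.sym (a#f i i≢i₀)
  ... | no i≢i₀ | no j≢i₀ = f# i j i≢i₀ j≢i₀ i≢j

infix 4 _∈?ₗ_
_∈?ₗ_ : ∀ (x : Fin n) xs → Dec (x ∈ xs)
_∈?ₗ_ = DecMembership._∈?_ _≟ᶠ_

-- Pigeonhole: if every list met X, picking a common element from each would give q distinct elements of X.
opaque
  some-avoids : ∀ (R : Fin q → List (Fin n)) → PairwiseDisjoint R →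
                (X : Subset n) → ∣ X ∣ < q → ∃ λ i → All (_∉ₛ X) (R i)
  some-avoids {q} {n} R disjoint X ∣X∣<q with any? (λ i → ¬? (Any.any? (_∈? X) (R i)))
  ... | yes (i , misses) = i , ¬Any⇒All¬ (R i) misses
  ... | no none = ⊥-elim (<⇒≱ ∣X∣<q (subst (_≤ ∣ X ∣) (length-tabulate hit) (length≤∣p∣ X distinct inX)))
    where
    meets : ∀ i → ∃ λ z → z ∈ R i × z ∈ₛ X
    meets i = find (decidable-stable (Any.any? (_∈? X) (R i)) (λ misses → none (i , misses)))
    hit : Fin q → Fin n
    hit = proj₁ ∘ meets
    distinct : Unique (tabulate hit)
    distinct = Unique.tabulate⁺ injective
      where
      injective : ∀ {i j} → hit i ≡ hit j → i ≡ j
      injective {i} {j} hiti≡hitj with i ≟ᶠ j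
      ... | yes i≡j = i≡j
      ... | no i≢j  = ⊥-elim (disjoint i j i≢j
        (proj₁ (proj₂ (meets i)) , subst (_∈ R j) (sym hiti≡hitj) (proj₁ (proj₂ (meets j)))))
    inX : All (_∈ₛ X) (tabulate hit)
    inX = Allₚ.tabulate⁺ (proj₂ ∘ proj₂ ∘ meets)

  ∃∉ : ∀ (X : Subset n) → ∣ X ∣ < n → ∃ λ x → x ∉ₛ X
  ∃∉ X ∣X∣<n with some-avoids (_∷ []) (λ { i j i≢j (here refl , here i≡j) → i≢j i≡j }) X ∣X∣<n
  ... | x , x∉X ∷ [] = x , x∉X

Unique-++⁻ : ∀ {A : Set} (xs : List A) {ys} → Unique (xs ++ ys) → Unique xs × Unique ys × Disjoint xs ys
Unique-++⁻ []       ys!              = [] , ys! , λ ()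
Unique-++⁻ (x ∷ xs) (x∉xsys ∷ xsys!) with Unique-++⁻ xs xsys!
... | xs! , ys! , xs#ys = Allₚ.++⁻ˡ xs x∉xsys ∷ xs! , ys! , λ
  { (here refl , y∈ys) → All.lookup x∉xsys (∈-++⁺ʳ xs y∈ys) refl
  ; (there y∈xs , y∈ys) → xs#ys (y∈xs , y∈ys) }

Unique-between : ∀ {A : Set} {u v : A} ys → Unique (u ∷ ys ++ v ∷ []) → All (λ z → z ≢ u × z ≢ v) ys
Unique-between {u = u} {v} ys (u∉ ∷ ys!) = All.tabulate λ z∈ →
  (λ z≡u → All.lookup u∉ (∈-++⁺ˡ z∈) (sym z≡u)) , λ z≡v → proj₂ (proj₂ (Unique-++⁻ ys ys!)) (z∈ , here z≡v)

infixr 5 _∷⟨_⟩_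

data Walk {n : ℕ} (E : Fin n → Fin n → Set) : Fin n → Fin n → Set where
  [_]    : ∀ x → Walk E x x
  _∷⟨_⟩_ : ∀ x {y z} → E x y → Walk E y z → Walk E x z

module _ {E : Fin n → Fin n → Set} where

  private variable
    s t r : Fin n

  infixr 5 _++ʷ_

  body : Walk E s t → List (Fin n)
  body [ x ]          = []
  body (x ∷⟨ _ ⟩ w) = x ∷ body w

  verts : Walk E s t → List (Fin n)
  verts {t = t} w = body w ++ t ∷ []

  interior : Walk E s t → List (Fin n)
  interior [ x ]          = []
  interior (x ∷⟨ _ ⟩ w) = body w

  _++ʷ_ : Walk E s r → Walk E r t → Walk E s t
  [ x ]          ++ʷ q = q
  (x ∷⟨ e ⟩ p) ++ʷ q = x ∷⟨ e ⟩ (p ++ʷ q)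

  verts-++ʷ : ∀ (p : Walk E s r) (q : Walk E r t) → verts (p ++ʷ q) ≡ body p ++ verts q
  verts-++ʷ [ x ]          q = refl
  verts-++ʷ (x ∷⟨ e ⟩ p) q = cong (x ∷_) (verts-++ʷ p q)

  start∈ : ∀ (w : Walk E s t) → s ∈ verts w
  start∈ [ x ]          = here refl
  start∈ (x ∷⟨ _ ⟩ w) = here refl

  end∈ : ∀ (w : Walk E s t) → t ∈ verts w
  end∈ w = ∈-++⁺ʳ (body w) (here refl)

  ∈-++ʷ⁻ : ∀ (p : Walk E s r) (q : Walk E r t) {z} → z ∈ verts (p ++ʷ q) → z ∈ verts p ⊎ z ∈ verts q
  ∈-++ʷ⁻ p q z∈ with ∈-++⁻ (body p) (subst (_ ∈_) (verts-++ʷ p q) z∈)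
  ... | inj₁ z∈p = inj₁ (∈-++⁺ˡ z∈p)
  ... | inj₂ z∈q = inj₂ z∈q

  ∈-++ʷ⁺ˡ : ∀ (p : Walk E s r) (q : Walk E r t) {z} → z ∈ verts p → z ∈ verts (p ++ʷ q)
  ∈-++ʷ⁺ˡ {r = r} p q {z} z∈ = subst (z ∈_) (sym (verts-++ʷ p q)) (case (∈-++⁻ (body p) z∈))
    where
    case : z ∈ body p ⊎ z ∈ r ∷ [] → z ∈ body p ++ verts q
    case (inj₁ z∈p)         = ∈-++⁺ˡ z∈p
    case (inj₂ (here z≡r)) = ∈-++⁺ʳ (body p) (subst (_∈ verts q) (sym z≡r) (start∈ q))

  ∈-++ʷ⁺ʳ : ∀ (p : Walk E s r) (q : Walk E r t) {z} → z ∈ verts q → z ∈ verts (p ++ʷ q)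
  ∈-++ʷ⁺ʳ p q {z} z∈ = subst (z ∈_) (sym (verts-++ʷ p q)) (∈-++⁺ʳ (body p) z∈)

  Unique-++ʷ⁺ : ∀ (p : Walk E s r) (q : Walk E r t) → Unique (verts p) → Unique (verts q) →
                (∀ {z} → z ∈ verts p → z ∈ verts q → z ≡ r) → Unique (verts (p ++ʷ q))
  Unique-++ʷ⁺ p q p! q! meet with Unique-++⁻ (body p) p!
  ... | body! , _ , body#r = subst Unique (sym (verts-++ʷ p q)) (Unique.++⁺ body! q! λ (z∈p , z∈q) →
    body#r (z∈p , here (meet (∈-++⁺ˡ z∈p) z∈q)))

  record Split (w : Walk E s t) (r : Fin n) : Set where
    field
      prefix   : Walk E s r
      suffix   : Walk E r t
      prefix!  : Unique (verts prefix)
      suffix!  : Unique (verts suffix)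
      prefix⊆  : ∀ {z} → z ∈ verts prefix → z ∈ verts w
      suffix⊆  : ∀ {z} → z ∈ verts suffix → z ∈ verts w
      meet     : ∀ {z} → z ∈ verts prefix → z ∈ verts suffix → z ≡ r

  split-++ʷ : ∀ (p : Walk E s r) (q : Walk E r t) → Unique (verts (p ++ʷ q)) → Split (p ++ʷ q) r
  split-++ʷ {r = r} p q pq! with Unique-++⁻ (body p) (subst Unique (verts-++ʷ p q) pq!)
  ... | body! , q! , body#q = record
    { prefix = p ; suffix = q ; prefix! = p! ; suffix! = q!
    ; prefix⊆ = ∈-++ʷ⁺ˡ p q ; suffix⊆ = ∈-++ʷ⁺ʳ p q ; meet = meet }
    where
    meet : ∀ {z} → z ∈ verts p → z ∈ verts q → z ≡ r
    meet z∈p z∈q with ∈-++⁻ (body p) z∈p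
    ... | inj₁ z∈body     = ⊥-elim (body#q (z∈body , z∈q))
    ... | inj₂ (here z≡r) = z≡r
    p! : Unique (verts p)
    p! = Unique.++⁺ body! ([] ∷ []) λ { (z∈body , here refl) → body#q (z∈body , start∈ q) }

  split : ∀ (w : Walk E s t) → Unique (verts w) → ∀ {r} → r ∈ verts w → Split w r
  split w w! r∈ with decompose w r∈
    where
    decompose : ∀ {s t} (w : Walk E s t) {r} → r ∈ verts w → Σ (Walk E s r) λ p → Σ (Walk E r t) λ q → w ≡ p ++ʷ q
    decompose [ x ]          (here refl) = [ x ] , [ x ] , refl
    decompose (x ∷⟨ e ⟩ w) (here refl) = [ x ] , x ∷⟨ e ⟩ w , refl
    decompose (x ∷⟨ e ⟩ w) (there r∈) with decompose w r∈
    ... | p , q , refl = x ∷⟨ e ⟩ p , q , refl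
  ... | p , q , refl = split-++ʷ p q w!

  firstHit : ∀ {P : Fin n → Set} → Decidable P → ∀ (w : Walk E s t) → Unique (verts w) → ∀ {y} → y ∈ verts w → P y →
             ∃ λ r → Σ (Split w r) λ sp → P r × (∀ {z} → z ∈ verts (Split.prefix sp) → P z → z ≡ r)
  firstHit {P = P} P? w w! y∈ Py with go w y∈ Py
    where
    go : ∀ {s t} (w : Walk E s t) → ∀ {y} → y ∈ verts w → P y → ∃ λ r → Σ (Walk E s r) λ p → Σ (Walk E r t) λ q →
         w ≡ p ++ʷ q × P r × (∀ {z} → z ∈ verts p → P z → z ≡ r)
    go [ x ] (here refl) Px = x , [ x ] , [ x ] , refl , Px , λ { (here refl) _ → refl }
    go (x ∷⟨ e ⟩ w) y∈ Py with P? x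
    ... | yes Px = x , [ x ] , x ∷⟨ e ⟩ w , refl , Px , λ { (here refl) _ → refl }
    go (x ∷⟨ e ⟩ w) (here refl) Py | no ¬Px = ⊥-elim (¬Px Py)
    go (x ∷⟨ e ⟩ w) (there y∈) Py | no ¬Px with go w y∈ Py
    ... | r , p , q , refl , Pr , only = r , x ∷⟨ e ⟩ p , q , refl , Pr , λ
      { (here refl) Px → ⊥-elim (¬Px Px) ; (there z∈) Pz → only z∈ Pz }
  ... | r , p , q , refl , Pr , only = r , split-++ʷ p q w! , Pr , only

  lastHit : ∀ {P : Fin n → Set} → Decidable P → ∀ (w : Walk E s t) → Unique (verts w) →
            (∃ λ r → Σ (Split w r) λ sp → P r × (∀ {z} → z ∈ verts (Split.suffix sp) → P z → z ≡ r))
            ⊎ All (¬_ ∘ P) (verts w)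
  lastHit {P = P} P? w w! with go w
    where
    go : ∀ {s t} (w : Walk E s t) →
         (∃ λ r → Σ (Walk E s r) λ p → Σ (Walk E r t) λ q →
            w ≡ p ++ʷ q × P r × (∀ {z} → z ∈ verts q → P z → z ≡ r))
         ⊎ All (¬_ ∘ P) (verts w)
    go [ x ] with P? x
    ... | yes Px = inj₁ (x , [ x ] , [ x ] , refl , Px , λ { (here refl) _ → refl })
    ... | no ¬Px = inj₂ (¬Px ∷ [])
    go (x ∷⟨ e ⟩ w) with go w
    ... | inj₁ (r , p , q , refl , Pr , only) = inj₁ (r , x ∷⟨ e ⟩ p , q , refl , Pr , only)
    ... | inj₂ ¬P with P? x
    ...   | yes Px = inj₁ (x , [ x ] , x ∷⟨ e ⟩ w , refl , Px , λ
      { (here refl) _ → refl ; (there z∈) Pz → ⊥-elim (All.lookup ¬P z∈ Pz) })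
    ...   | no ¬Px = inj₂ (¬Px ∷ ¬P)
  ... | inj₁ (r , p , q , refl , Pr , only) = inj₁ (r , split-++ʷ p q w! , Pr , only)
  ... | inj₂ ¬P = inj₂ ¬P

  shorten : ∀ (w : Walk E s t) → Σ (Walk E s t) λ w′ → Unique (verts w′) × (∀ {z} → z ∈ verts w′ → z ∈ verts w)
  shorten [ x ] = [ x ] , [] ∷ [] , λ z∈ → z∈
  shorten (x ∷⟨ e ⟩ w) with shorten w
  ... | w′ , w′! , w′⊆ with x ∈?ₗ verts w′
  ...   | yes x∈ = let open Split (split w′ w′! x∈) in suffix , suffix! , there ∘ w′⊆ ∘ suffix⊆
  ...   | no x∉  = x ∷⟨ e ⟩ w′ , All.tabulate (λ z∈ x≡z → x∉ (subst (_∈ verts w′) (sym x≡z) z∈)) ∷ w′! , λ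
    { (here refl) → here refl ; (there z∈) → there (w′⊆ z∈) }

  linked : ∀ (w : Walk E s t) → Linked E (verts w)
  linked [ x ]                       = [-]
  linked (x ∷⟨ e ⟩ [ y ])            = e ∷ [-]
  linked (x ∷⟨ e ⟩ (y ∷⟨ e′ ⟩ w)) = e ∷ linked (y ∷⟨ e′ ⟩ w)

  fromLinked : ∀ {u v} xs → Linked E (u ∷ xs ++ v ∷ []) → Σ (Walk E u v) λ w → verts w ≡ u ∷ xs ++ v ∷ []
  fromLinked []       (e ∷ [-]) = _ ∷⟨ e ⟩ [ _ ] , refl
  fromLinked (x ∷ xs) (e ∷ es) with fromLinked xs es
  ... | w , eq = _ ∷⟨ e ⟩ w , cong (_ ∷_) eq

  body≢[] : ∀ (w : Walk E s t) → s ≢ t → body w ≢ []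
  body≢[] [ x ]          x≢x = ⊥-elim (x≢x refl)
  body≢[] (x ∷⟨ _ ⟩ w) _   ()

  interior⊆verts : ∀ (w : Walk E s t) {z} → z ∈ interior w → z ∈ verts w
  interior⊆verts (x ∷⟨ _ ⟩ w) z∈ = there (∈-++⁺ˡ z∈)

  penultimate : ∀ (w : Walk E s t) → s ≢ t → ∃ λ b → b ∈ verts w × E b t
  penultimate [ x ]          x≢x = ⊥-elim (x≢x refl)
  penultimate (x ∷⟨ e ⟩ w) _   = go x e w
    where
    go : ∀ x {y} → E x y → (w : Walk E y t) → ∃ λ b → b ∈ x ∷ verts w × E b t
    go x e [ y ]          = x , here refl , e
    go x e (y ∷⟨ e′ ⟩ w) with go y e′ w
    ... | b , b∈ , b~t = b , there b∈ , b~t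

  linked-between : ∀ {R : Fin n → Fin n → Set} {u v} → (∀ {a b} → E a b → R a b) →
                   R u s → (w : Walk E s t) → R t v → Linked R (u ∷ verts w ++ v ∷ [])
  linked-between E⇒R u~s [ x ]          t~v = u~s ∷ t~v ∷ [-]
  linked-between E⇒R u~s (x ∷⟨ e ⟩ w) t~v = u~s ∷ linked-between E⇒R (E⇒R e) w t~v

module _ {E E′ : Fin n → Fin n → Set} {P : Fin n → Set} (E⇒E′ : ∀ {a b} → P a → P b → E a b → E′ a b) where

  restrictʷ : ∀ {s t} (w : Walk E s t) → All P (verts w) → Σ (Walk E′ s t) λ w′ → verts w′ ≡ verts w
  restrictʷ [ x ]          _         = [ x ] , refl
  restrictʷ (x ∷⟨ e ⟩ w) (Px ∷ Pw) =
    x ∷⟨ E⇒E′ Px (All.lookup Pw (start∈ w)) e ⟩ proj₁ (restrictʷ w Pw) , cong (x ∷_) (proj₂ (restrictʷ w Pw))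

module _ {A : Set} {R : A → A → Set} where

  Linked-sources : ∀ {P : A → Set} ys {v} → Linked R (ys ++ v ∷ []) → All P ys →
                   Linked (λ a b → R a b × P a) (ys ++ v ∷ [])
  Linked-sources []            _          _          = [-]
  Linked-sources (y ∷ [])      (r ∷ [-])  (p ∷ [])   = (r , p) ∷ [-]
  Linked-sources (y ∷ y′ ∷ ys) (r ∷ rs)   (p ∷ ps)   = (r , p) ∷ Linked-sources (y′ ∷ ys) rs ps

-- Menger's theorem

-- Göring's proof (Diestel, Graph Theory, Thm 3.3.1): fewer than k disjoint A–B paths can be augmented,
-- by induction on the number of vertices outside B.
module Menger {n : ℕ} (E : Fin n → Fin n → Set) (A : Subset n) where

  private variable
    u v : Fin n
    B B′ : Subset n
    j : ℕ

  record _⇝_ (u : Fin n) (B : Subset n) : Set where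
    field
      {end}     : Fin n
      walk      : Walk E u end
      unique    : Unique (verts walk)
      end∈B     : end ∈ₛ B
      only-end∈B : ∀ {z} → z ∈ verts walk → z ∈ₛ B → z ≡ end

    V : List (Fin n)
    V = verts walk

  open _⇝_ public

  record ABPath (B : Subset n) : Set where
    field
      {start} : Fin n
      start∈A : start ∈ₛ A
      path    : start ⇝ B

  open ABPath public

  Vₐ : ABPath B → List (Fin n)
  Vₐ P = V (path P)

  endₐ : ABPath B → Fin n
  endₐ P = end (path P)

  truncate : ∀ {t} (w : Walk E u t) → Unique (verts w) → ∀ {b} → b ∈ verts w → b ∈ₛ B →
             Σ (u ⇝ B) λ T → ∀ {z} → z ∈ V T → z ∈ verts w
  truncate {B = B} w w! b∈w b∈B with firstHit (_∈? B) w w! b∈w b∈B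
  ... | r , sp , r∈B , first = record
    { walk = prefix ; unique = prefix! ; end∈B = r∈B ; only-end∈B = first } , prefix⊆
    where open Split sp

  from : ∀ (T : u ⇝ B) → Split (walk T) v → v ⇝ B
  from T sp = record
    { walk = suffix ; unique = suffix! ; end∈B = end∈B T ; only-end∈B = λ z∈ → only-end∈B T (suffix⊆ z∈) }
    where open Split sp

  Concatenation : u ⇝ B′ → v ⇝ B → Set
  Concatenation {u = u} {B = B} T T′ = Σ (u ⇝ B) λ T″ → end T″ ≡ end T′ × (∀ {z} → z ∈ V T″ → z ∈ V T ⊎ z ∈ V T′)

  module _ (B⊆B′ : B ⊆ B′) where

    narrow : ∀ (T : u ⇝ B′) → end T ∈ₛ B → u ⇝ B
    narrow T end∈B = record
      { walk = walk T ; unique = unique T ; end∈B = end∈B ; only-end∈B = λ z∈ z∈B → only-end∈B T z∈ (B⊆B′ z∈B) }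

    widen : ∀ (T : u ⇝ B) → (∀ {z} → z ∈ V T → z ∈ₛ B′ → z ∈ₛ B) → u ⇝ B′
    widen T T∩B′⊆B = record
      { walk = walk T ; unique = unique T ; end∈B = B⊆B′ (end∈B T)
      ; only-end∈B = λ z∈ z∈B′ → only-end∈B T z∈ (T∩B′⊆B z∈ z∈B′) }

    join : ∀ (T : u ⇝ B′) (T′ : v ⇝ B) → end T ≡ v → (∀ {z} → z ∈ V T′ → z ∈ₛ B′) → Concatenation T T′
    join T T′ refl T′⊆B′ = record
      { walk = walk T ++ʷ walk T′
      ; unique = Unique-++ʷ⁺ (walk T) (walk T′) (unique T) (unique T′)
                             (λ z∈T z∈T′ → only-end∈B T z∈T (T′⊆B′ z∈T′))
      ; end∈B = end∈B T′
      ; only-end∈B = once } , refl , ∈-++ʷ⁻ (walk T) (walk T′)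
      where
      once : ∀ {z} → z ∈ verts (walk T ++ʷ walk T′) → z ∈ₛ B → z ≡ end T′
      once z∈ z∈B with ∈-++ʷ⁻ (walk T) (walk T′) z∈
      ... | inj₁ z∈T  =
        only-end∈B T′ (subst (_∈ V T′) (sym (only-end∈B T z∈T (B⊆B′ z∈B))) (start∈ (walk T′))) z∈B
      ... | inj₂ z∈T′ = only-end∈B T′ z∈T′ z∈B

  Disjointₐ : (Fin j → ABPath B) → Set
  Disjointₐ P = PairwiseDisjoint (Vₐ ∘ P)

  NoSeparator : ℕ → Subset n → Set
  NoSeparator k B = ∀ X → ∣ X ∣ < k → Σ (ABPath B) λ R → All (_∉ₛ X) (Vₐ R)

  Augmentation : ∀ B → (Fin j → ABPath B) → Set
  Augmentation {j} B P = Σ (Fin (suc j) → ABPath B) λ Q → Disjointₐ Q × (∀ i → endₐ (Q (suc i)) ≡ endₐ (P i))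

  NoSeparator-⊆ : ∀ {k} → B ⊆ B′ → NoSeparator k B → NoSeparator k B′
  NoSeparator-⊆ B⊆B′ nosep X ∣X∣<k with nosep X ∣X∣<k
  ... | R , R∉X with truncate (walk (path R)) (unique (path R)) (end∈ (walk (path R))) (B⊆B′ (end∈B (path R)))
  ...   | T , T⊆R = record { start∈A = start∈A R ; path = T } , All.tabulate (All.lookup R∉X ∘ T⊆R)

  ends : (Fin j → ABPath B) → Subset n
  ends P = setOf (tabulate (endₐ ∘ P))

  ∣ends∣≤ : ∀ (P : Fin j → ABPath B) → ∣ ends P ∣ ≤ j
  ∣ends∣≤ P = ≤-trans (∣setOf∣≤length (tabulate (endₐ ∘ P))) (≤-reflexive (length-tabulate (endₐ ∘ P)))

  end∈ends : ∀ (P : Fin j → ABPath B) i → endₐ (P i) ∈ₛ ends P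
  end∈ends P i = ∈-setOf⁺ (∈-tabulate⁺ i)

  module Step {k B} (nosep : NoSeparator k B) {j} (j<k : j < k) (P : Fin j → ABPath B) (P# : Disjointₐ P)
              (recurse : ∀ {B′} → ∣ B ∣ < ∣ B′ ∣ → NoSeparator k B′ →
                         (P′ : Fin j → ABPath B′) → Disjointₐ P′ → Augmentation B′ P′) where

    R : ABPath B
    R = proj₁ (nosep (ends P) (≤-<-trans (∣ends∣≤ P) j<k))

    R∉ends : All (_∉ₛ ends P) (Vₐ R)
    R∉ends = proj₂ (nosep (ends P) (≤-<-trans (∣ends∣≤ P) j<k))

    OnP : Fin n → Set
    OnP z = ∃ λ i → z ∈ Vₐ (P i)

    -- R last meets the paths of P at x, on P ip.  Adding the tails T₁ of P ip and T₂ of R beyond x to B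
    -- gives a larger target B⁺; the paths provided by induction for B⁺ are then rerouted along T₁ and T₂.
    module Crossing {x} (Rsplit : Split (walk (path R)) x) (ip : Fin j) (x∈Pip : x ∈ Vₐ (P ip))
                    (last : ∀ {z} → z ∈ verts (Split.suffix Rsplit) → OnP z → z ≡ x) where

      Psplit : Split (walk (path (P ip))) x
      Psplit = split (walk (path (P ip))) (unique (path (P ip))) x∈Pip

      T₁ T₂ : x ⇝ B
      T₁ = from (path (P ip)) Psplit
      T₂ = from (path R) Rsplit

      T₁⊆Pip : ∀ {z} → z ∈ V T₁ → z ∈ Vₐ (P ip)
      T₁⊆Pip = Split.suffix⊆ Psplit

      T₂∩P : ∀ {z} i → z ∈ V T₂ → z ∈ Vₐ (P i) → z ≡ x
      T₂∩P i z∈T₂ z∈Pi = last z∈T₂ (i , z∈Pi)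

      T₁∩T₂ : ∀ {z} → z ∈ V T₁ → z ∈ V T₂ → z ≡ x
      T₁∩T₂ z∈T₁ z∈T₂ = T₂∩P ip z∈T₂ (T₁⊆Pip z∈T₁)

      x∉B : x ∉ₛ B
      x∉B x∈B = All.lookup R∉ends (Split.suffix⊆ Rsplit (start∈ (walk T₂)))
        (subst (_∈ₛ ends P) (sym (only-end∈B (path (P ip)) x∈Pip x∈B)) (end∈ends P ip))

      B⁺ : Subset n
      B⁺ = B ∪ (setOf (V T₁) ∪ setOf (V T₂))

      B⊆B⁺ : B ⊆ B⁺
      B⊆B⁺ z∈B = SubP.x∈p∪q⁺ (inj₁ z∈B)

      T₁⊆B⁺ : ∀ {z} → z ∈ V T₁ → z ∈ₛ B⁺
      T₁⊆B⁺ z∈ = SubP.x∈p∪q⁺ (inj₂ (SubP.x∈p∪q⁺ (inj₁ (∈-setOf⁺ z∈))))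

      T₂⊆B⁺ : ∀ {z} → z ∈ V T₂ → z ∈ₛ B⁺
      T₂⊆B⁺ z∈ = SubP.x∈p∪q⁺ (inj₂ (SubP.x∈p∪q⁺ (inj₂ (∈-setOf⁺ z∈))))

      ∈B⁺⁻ : ∀ {z} → z ∈ₛ B⁺ → z ∈ₛ B ⊎ z ∈ V T₁ ⊎ z ∈ V T₂
      ∈B⁺⁻ z∈ with SubP.x∈p∪q⁻ B _ z∈
      ... | inj₁ z∈B = inj₁ z∈B
      ... | inj₂ z∈T with SubP.x∈p∪q⁻ (setOf (V T₁)) _ z∈T
      ...   | inj₁ z∈T₁ = inj₂ (inj₁ (∈-setOf⁻ (V T₁) z∈T₁))
      ...   | inj₂ z∈T₂ = inj₂ (inj₂ (∈-setOf⁻ (V T₂) z∈T₂))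

      ∣B∣<∣B⁺∣ : ∣ B ∣ < ∣ B⁺ ∣
      ∣B∣<∣B⁺∣ = SubP.p⊂q⇒∣p∣<∣q∣ (B⊆B⁺ , x , T₁⊆B⁺ (start∈ (walk T₁)) , x∉B)

      Px : ABPath B⁺
      Px = record { start∈A = start∈A (P ip) ; path = record
        { walk = prefix ; unique = prefix! ; end∈B = T₁⊆B⁺ (start∈ suffix) ; only-end∈B = once } }
        where
        open Split Psplit
        once : ∀ {z} → z ∈ verts prefix → z ∈ₛ B⁺ → z ≡ x
        once z∈ z∈B⁺ with ∈B⁺⁻ z∈B⁺
        ... | inj₁ z∈B         = meet z∈ (subst (_∈ verts suffix)
                                   (sym (only-end∈B (path (P ip)) (prefix⊆ z∈) z∈B)) (end∈ suffix))
        ... | inj₂ (inj₁ z∈T₁) = meet z∈ z∈T₁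
        ... | inj₂ (inj₂ z∈T₂) = T₂∩P ip z∈T₂ (prefix⊆ z∈)

      other : ∀ i → i ≢ ip → ABPath B⁺
      other i i≢ip = record { start∈A = start∈A (P i) ; path = widen B⊆B⁺ (path (P i)) avoids }
        where
        avoids : ∀ {z} → z ∈ Vₐ (P i) → z ∈ₛ B⁺ → z ∈ₛ B
        avoids z∈ z∈B⁺ with ∈B⁺⁻ z∈B⁺
        ... | inj₁ z∈B         = z∈B
        ... | inj₂ (inj₁ z∈T₁) = ⊥-elim (P# i ip i≢ip (z∈ , T₁⊆Pip z∈T₁))
        ... | inj₂ (inj₂ z∈T₂) =
          ⊥-elim (P# i ip i≢ip (z∈ , subst (_∈ Vₐ (P ip)) (sym (T₂∩P i z∈T₂ z∈)) x∈Pip))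

      P′ : Fin j → ABPath B⁺
      P′ = select ip Px other

      P′⊆P : ∀ i {z} → z ∈ Vₐ (P′ i) → z ∈ Vₐ (P i)
      P′⊆P = select-elim (λ i Q → ∀ {z} → z ∈ Vₐ Q → z ∈ Vₐ (P i)) (Split.prefix⊆ Psplit) (λ _ _ z∈ → z∈)

      -- Opaque, so that the with-abstractions below do not unfold the recursive call.
      opaque
        recursion : Augmentation B⁺ P′
        recursion = recurse ∣B∣<∣B⁺∣ (NoSeparator-⊆ B⊆B⁺ nosep) P′ (disjoint-⊆ P# P′⊆P)

      Q′ : Fin (suc j) → ABPath B⁺
      Q′ = proj₁ recursion

      Q′# : Disjointₐ Q′
      Q′# = proj₁ (proj₂ recursion)

      Q′-end : ∀ i → i ≢ ip → endₐ (Q′ (suc i)) ≡ endₐ (P i)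
      Q′-end i i≢ip =
        trans (proj₂ (proj₂ recursion) i) (select-away (λ i Q → endₐ Q ≡ endₐ (P i)) (λ _ _ → refl) i≢ip)

      qₓ-end : endₐ (Q′ (suc ip)) ≡ x
      qₓ-end = trans (proj₂ (proj₂ recursion) ip) (cong endₐ (select-at {a = Px} {f = other}))

      q₀ qₓ : ABPath B⁺
      q₀ = Q′ zero
      qₓ = Q′ (suc ip)

      y : Fin n
      y = endₐ q₀

      y≢x : y ≢ x
      y≢x y≡x = Q′# zero (suc ip) (λ ())
        (end∈ (walk (path q₀)) , subst (_∈ Vₐ qₓ) (trans qₓ-end (sym y≡x)) (end∈ (walk (path qₓ))))

      Fresh : List (Fin n) → Set
      Fresh zs = ∀ i → i ≢ ip → Disjoint zs (Vₐ (Q′ (suc i)))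

      fresh-∪ : ∀ {xs ys zs} → (∀ {z} → z ∈ zs → z ∈ xs ⊎ z ∈ ys) → Fresh xs → Fresh ys → Fresh zs
      fresh-∪ zs⊆ xs-fresh ys-fresh i i≢ip (z∈zs , z∈Qi) with zs⊆ z∈zs
      ... | inj₁ z∈xs = xs-fresh i i≢ip (z∈xs , z∈Qi)
      ... | inj₂ z∈ys = ys-fresh i i≢ip (z∈ys , z∈Qi)

      fresh-⊆ : ∀ {xs ys} → (∀ {z} → z ∈ ys → z ∈ xs) → Fresh xs → Fresh ys
      fresh-⊆ ys⊆xs xs-fresh i i≢ip (z∈ys , z∈Qi) = xs-fresh i i≢ip (ys⊆xs z∈ys , z∈Qi)

      fresh-q₀ : Fresh (Vₐ q₀)
      fresh-q₀ i _ = Q′# zero (suc i) (λ ())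

      fresh-qₓ : Fresh (Vₐ qₓ)
      fresh-qₓ i i≢ip = Q′# (suc ip) (suc i) (i≢ip ∘ sym ∘ Fin.suc-injective)

      fresh-tail : ∀ (T : x ⇝ B) → (∀ {z} → z ∈ V T → z ∈ₛ B⁺) → (∀ i → i ≢ ip → endₐ (P i) ∉ V T) →
                   Fresh (V T)
      fresh-tail T T⊆B⁺ end∉T i i≢ip (z∈T , z∈Qi) =
        end∉T i i≢ip (subst (_∈ V T) (trans (only-end∈B (path (Q′ (suc i))) z∈Qi (T⊆B⁺ z∈T)) (Q′-end i i≢ip)) z∈T)

      fresh-T₁ : Fresh (V T₁)
      fresh-T₁ = fresh-tail T₁ T₁⊆B⁺ λ i i≢ip e∈T₁ → P# i ip i≢ip (end∈ (walk (path (P i))) , T₁⊆Pip e∈T₁)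

      fresh-T₂ : Fresh (V T₂)
      fresh-T₂ = fresh-tail T₂ T₂⊆B⁺ λ i i≢ip e∈T₂ → P# i ip i≢ip
        (end∈ (walk (path (P i))) , subst (_∈ Vₐ (P ip)) (sym (T₂∩P i e∈T₂ (end∈ (walk (path (P i)))))) x∈Pip)

      record FreshPair (t t′ : Fin n) : Set where
        field
          first second : ABPath B
          first-end    : endₐ first ≡ t
          second-end   : endₐ second ≡ t′
          disjoint     : Disjoint (Vₐ first) (Vₐ second)
          first-fresh  : Fresh (Vₐ first)
          second-fresh : Fresh (Vₐ second)

      swap : ∀ {t t′} → FreshPair t t′ → FreshPair t′ t
      swap p = record
        { first = second ; second = first ; first-end = second-end ; second-end = first-end
        ; disjoint = Disjointₚ.sym disjoint ; first-fresh = second-fresh ; second-fresh = first-fresh }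
        where open FreshPair p

      assemble : ∀ {t} → FreshPair t (endₐ (P ip)) → Augmentation B P
      assemble p = first ∷ᵛ rest , disjoint-∷ Vₐ first#rest (disjoint-select Vₐ Q′-others# second-fresh) , rest-end
        where
        open FreshPair p
        narrowed : ∀ i → i ≢ ip → ABPath B
        narrowed i i≢ip = record { start∈A = start∈A (Q′ (suc i)) ; path = narrow B⊆B⁺ (path (Q′ (suc i)))
          (subst (_∈ₛ B) (sym (Q′-end i i≢ip)) (end∈B (path (P i)))) }
        rest : Fin j → ABPath B
        rest = select ip second narrowed
        Q′-others# : ∀ i i′ i≢ip i′≢ip → i ≢ i′ → Disjoint (Vₐ (narrowed i i≢ip)) (Vₐ (narrowed i′ i′≢ip))
        Q′-others# i i′ _ _ i≢i′ = Q′# (suc i) (suc i′) (i≢i′ ∘ Fin.suc-injective)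
        first#rest : ∀ i → Disjoint (Vₐ first) (Vₐ (rest i))
        first#rest = select-elim (λ _ W → Disjoint (Vₐ first) (Vₐ W)) disjoint first-fresh
        rest-end : ∀ i → endₐ (rest i) ≡ endₐ (P i)
        rest-end = select-elim (λ i W → endₐ W ≡ endₐ (P i)) second-end Q′-end

      -- Q′ 0 ends on one of the two tails: continue it along that tail, and send Q′ (suc ip) along the other.
      via : ∀ (Ta Tb : x ⇝ B) → (∀ {z} → z ∈ V Ta → z ∈ V Tb → z ≡ x) →
            (∀ {z} → z ∈ V Ta → z ∈ₛ B⁺) → (∀ {z} → z ∈ V Tb → z ∈ₛ B⁺) → Fresh (V Ta) → Fresh (V Tb) →
            y ∈ V Ta → FreshPair (end Ta) (end Tb)
      via Ta Tb Ta∩Tb Ta⊆B⁺ Tb⊆B⁺ Ta-fresh Tb-fresh y∈Ta = record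
        { first = record { start∈A = start∈A q₀ ; path = proj₁ first }
        ; second = record { start∈A = start∈A qₓ ; path = proj₁ second }
        ; first-end = proj₁ (proj₂ first) ; second-end = proj₁ (proj₂ second)
        ; disjoint = λ (z∈first , z∈second) → separate (proj₂ (proj₂ first) z∈first) (proj₂ (proj₂ second) z∈second)
        ; first-fresh = fresh-∪ (proj₂ (proj₂ first)) fresh-q₀ (fresh-⊆ suffix⊆ Ta-fresh)
        ; second-fresh = fresh-∪ (proj₂ (proj₂ second)) fresh-qₓ Tb-fresh }
        where
        Ta-split : Split (walk Ta) y
        Ta-split = split (walk Ta) (unique Ta) y∈Ta
        open Split Ta-split using (suffix⊆; meet; prefix)
        yTa : y ⇝ B
        yTa = from Ta Ta-split
        x∉yTa : x ∉ V yTa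
        x∉yTa x∈ = y≢x (sym (meet (start∈ prefix) x∈))
        first : Concatenation (path q₀) yTa
        first = join B⊆B⁺ (path q₀) yTa refl (Ta⊆B⁺ ∘ suffix⊆)
        second : Concatenation (path qₓ) Tb
        second = join B⊆B⁺ (path qₓ) Tb qₓ-end Tb⊆B⁺
        separate : ∀ {z} → z ∈ Vₐ q₀ ⊎ z ∈ V yTa → z ∈ Vₐ qₓ ⊎ z ∈ V Tb → ⊥
        separate (inj₁ z∈q₀) (inj₁ z∈qₓ) = Q′# zero (suc ip) (λ ()) (z∈q₀ , z∈qₓ)
        separate (inj₁ z∈q₀) (inj₂ z∈Tb) with only-end∈B (path q₀) z∈q₀ (Tb⊆B⁺ z∈Tb)
        ... | refl = y≢x (Ta∩Tb y∈Ta z∈Tb)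
        separate (inj₂ z∈yTa) (inj₁ z∈qₓ) =
          x∉yTa (subst (_∈ V yTa) (trans (only-end∈B (path qₓ) z∈qₓ (Ta⊆B⁺ (suffix⊆ z∈yTa))) qₓ-end) z∈yTa)
        separate (inj₂ z∈yTa) (inj₂ z∈Tb) = x∉yTa (subst (_∈ V yTa) (Ta∩Tb (suffix⊆ z∈yTa) z∈Tb) z∈yTa)

      -- Q′ 0 already ends in B: keep it, and extend Q′ (suc ip) along T₁.
      direct : y ∈ₛ B → y ∉ V T₁ → FreshPair y (end T₁)
      direct y∈B y∉T₁ = record
        { first = record { start∈A = start∈A q₀ ; path = narrow B⊆B⁺ (path q₀) y∈B }
        ; second = record { start∈A = start∈A qₓ ; path = proj₁ second }
        ; first-end = refl ; second-end = proj₁ (proj₂ second)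
        ; disjoint = λ (z∈q₀ , z∈second) → separate z∈q₀ (proj₂ (proj₂ second) z∈second)
        ; first-fresh = fresh-q₀
        ; second-fresh = fresh-∪ (proj₂ (proj₂ second)) fresh-qₓ fresh-T₁ }
        where
        second : Concatenation (path qₓ) T₁
        second = join B⊆B⁺ (path qₓ) T₁ qₓ-end T₁⊆B⁺
        separate : ∀ {z} → z ∈ Vₐ q₀ → z ∈ Vₐ qₓ ⊎ z ∈ V T₁ → ⊥
        separate z∈q₀ (inj₁ z∈qₓ) = Q′# zero (suc ip) (λ ()) (z∈q₀ , z∈qₓ)
        separate z∈q₀ (inj₂ z∈T₁) with only-end∈B (path q₀) z∈q₀ (T₁⊆B⁺ z∈T₁)
        ... | refl = y∉T₁ z∈T₁

      augmentation : Augmentation B P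
      augmentation with y ∈?ₗ V T₁ | y ∈?ₗ V T₂ | ∈B⁺⁻ (end∈B (path q₀))
      ... | yes y∈T₁ | _        | _ = assemble (swap (via T₁ T₂ T₁∩T₂ T₁⊆B⁺ T₂⊆B⁺ fresh-T₁ fresh-T₂ y∈T₁))
      ... | no _     | yes y∈T₂ | _ =
        assemble (via T₂ T₁ (λ z∈T₂ z∈T₁ → T₁∩T₂ z∈T₁ z∈T₂) T₂⊆B⁺ T₁⊆B⁺ fresh-T₂ fresh-T₁ y∈T₂)
      ... | no y∉T₁  | no _     | inj₁ y∈B = assemble (direct y∈B y∉T₁)
      ... | no y∉T₁  | no _     | inj₂ (inj₁ y∈T₁) = ⊥-elim (y∉T₁ y∈T₁)
      ... | no _     | no y∉T₂  | inj₂ (inj₂ y∈T₂) = ⊥-elim (y∉T₂ y∈T₂)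

    augmentation : Augmentation B P
    augmentation with lastHit (λ z → any? (λ i → z ∈?ₗ Vₐ (P i))) (walk (path R)) (unique (path R))
    ... | inj₁ (x , Rsplit , (ip , x∈Pip) , last) = Crossing.augmentation Rsplit ip x∈Pip last
    ... | inj₂ R∉P = R ∷ᵛ P , disjoint-∷ Vₐ (λ i (z∈R , z∈Pi) → All.lookup R∉P z∈R (i , z∈Pi)) P# , λ _ → refl

  augment : ∀ {k} d {B} → n ≤ ∣ B ∣ + d → NoSeparator k B →
            ∀ {j} → j < k → (P : Fin j → ABPath B) → Disjointₐ P → Augmentation B P
  augment zero {B} n≤∣B∣ nosep j<k P P# = Step.augmentation nosep j<k P P# λ {B′} ∣B∣<∣B′∣ → ⊥-elim
    (<⇒≱ ∣B∣<∣B′∣ (≤-trans (SubP.∣p∣≤n B′) (subst (n ≤_) (+-identityʳ ∣ B ∣) n≤∣B∣)))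
  augment (suc d) {B} n≤∣B∣+1+d nosep j<k P P# = Step.augmentation nosep j<k P P# λ {B′} ∣B∣<∣B′∣ nosep′ →
    augment d (≤-trans n≤∣B∣+1+d (≤-trans (≤-reflexive (+-suc ∣ B ∣ d)) (+-monoˡ-≤ d ∣B∣<∣B′∣))) nosep′ j<k

  menger : ∀ {k B} → NoSeparator k B → Σ (Fin k → ABPath B) Disjointₐ
  menger {k} {B} nosep = go k ≤-refl
    where
    go : ∀ j → j ≤ k → Σ (Fin j → ABPath B) Disjointₐ
    go zero    _   = (λ ()) , λ ()
    go (suc j) j<k with go j (<⇒≤ j<k)
    ... | P , P# with augment n (m≤n+m n ∣ B ∣) nosep j<k P P#
    ...   | Q , Q# , _ = Q , Q#

-- Internally disjoint paths in k-connected graphs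

Nbr : Graph n → Fin n → Subset n
Nbr G x = Vec.tabulate (adj G x)

module _ (G : Graph n) {x z : Fin n} where

  ∈Nbr⁺ : Adj G x z → z ∈ₛ Nbr G x
  ∈Nbr⁺ x~z = lookup⇒[]= z (Nbr G x) (trans (lookup∘tabulate (adj G x) z) x~z)

  ∈Nbr⁻ : z ∈ₛ Nbr G x → Adj G x z
  ∈Nbr⁻ z∈ = trans (sym (lookup∘tabulate (adj G x) z)) ([]=⇒lookup z∈)

≟∧≟-false : ∀ {a b c d : Fin n} → ¬ (a ≡ c × b ≡ d) → does (a ≟ᶠ c) ∧ does (b ≟ᶠ d) ≡ false
≟∧≟-false {a = a} {b} {c} {d} ¬both with a ≟ᶠ c | b ≟ᶠ d
... | yes a≡c | yes b≡d = ⊥-elim (¬both (a≡c , b≡d))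
... | yes _   | no _    = refl
... | no _    | _       = refl

module _ (G : Graph n) {u v : Fin n} where

  deleteEdge-⊆ : ∀ {a b} → Adj (deleteEdge G u v) a b → Adj G a b
  deleteEdge-⊆ {a} {b} = ∧-conicalˡ (adj G a b) _

  deleteEdge-removes : ¬ Adj (deleteEdge G u v) u v
  deleteEdge-removes u~v rewrite dec-true (u ≟ᶠ u) refl | dec-true (v ≟ᶠ v) refl | ∧-zeroʳ (adj G u v) with u~v
  ... | ()

  deleteEdge-removes′ : ¬ Adj (deleteEdge G u v) v u
  deleteEdge-removes′ v~u = deleteEdge-removes (trans (adj-sym (deleteEdge G u v) u v) v~u)

  deleteEdge-keeps : ∀ {a b} → Adj G a b → ¬ (a ≡ u × b ≡ v) → ¬ (a ≡ v × b ≡ u) → Adj (deleteEdge G u v) a b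
  deleteEdge-keeps a~b ¬uv ¬vu rewrite a~b | ≟∧≟-false ¬uv | ≟∧≟-false ¬vu = refl

module _ (G : Graph n) where

  Adj-irrefl : ∀ {x} → ¬ Adj G x x
  Adj-irrefl {x} x~x with trans (sym (adj-irr G x)) x~x
  ... | ()

  interior-∉ends : ∀ {u v} (w : Walk (Adj G) u v) → Unique (verts w) → ∀ {z} → z ∈ interior w → z ≢ u × z ≢ v
  interior-∉ends (x ∷⟨ _ ⟩ w) w! = All.lookup (Unique-between (body w) w!)

  walk⇒IsPath : ∀ {u v} (w : Walk (Adj G) u v) → u ≢ v → Unique (verts w) → IsPath G u v (interior w)
  walk⇒IsPath [ x ]          x≢x _  = ⊥-elim (x≢x refl)
  walk⇒IsPath (x ∷⟨ e ⟩ w) _   w! = linked (x ∷⟨ e ⟩ w) , w!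

  walk⇒PathAvoiding : ∀ {X u v} (w : Walk (Adj G) u v) → u ≢ v →
                      (∀ {z} → z ∈ verts w → z ≢ u → z ≢ v → z ∉ₛ X) → PathAvoiding G X u v
  walk⇒PathAvoiding w u≢v avoids with shorten w
  ... | w′ , w′! , w′⊆w = interior w′ , walk⇒IsPath w′ u≢v w′! , All.tabulate λ z∈ →
    let z≢u , z≢v = interior-∉ends w′ w′! z∈ in avoids (w′⊆w (interior⊆verts w′ z∈)) z≢u z≢v

  PathAvoiding⇒walk : ∀ {X a b} → PathAvoiding G X a b →
                      Σ (Walk (Adj G) a b) λ w → Unique (verts w) × All (λ z → z ≡ a ⊎ z ≡ b ⊎ z ∉ₛ X) (verts w)
  PathAvoiding⇒walk {X} {a} {b} (xs , (lk , uq) , xs∉) with fromLinked xs lk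
  ... | w , w≡ = w , subst Unique (sym w≡) uq , subst (All Kind) (sym w≡)
    (inj₁ refl ∷ Allₚ.++⁺ (All.map (inj₂ ∘ inj₂) xs∉) (inj₂ (inj₁ refl) ∷ []))
    where
    Kind : Fin n → Set
    Kind z = z ≡ a ⊎ z ≡ b ⊎ z ∉ₛ X

  IsPath[]⇒Adj : ∀ {u v} → IsPath G u v [] → Adj G u v
  IsPath[]⇒Adj (u~v ∷ _ , _) = u~v

  edge-IsPath : ∀ {u v} → Adj G u v → u ≢ v → IsPath G u v []
  edge-IsPath u~v u≢v = u~v ∷ [-] , (u≢v ∷ []) ∷ [] ∷ []

  extend : ∀ {k u v xs} (P : HasDisjointPaths G k u v) → IsPath G u v xs →
           (∀ i → xs ≢ proj₁ P i) → (∀ i → Disjoint xs (proj₁ P i)) → HasDisjointPaths G (suc k) u v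
  extend {xs = xs} (P , P-path , P#) xs-path xs≢P xs#P = xs ∷ᵛ P , path , distinct
    where
    path : ∀ i → IsPath G _ _ ((xs ∷ᵛ P) i)
    path zero    = xs-path
    path (suc i) = P-path i
    distinct : ∀ i j → i ≢ j → (xs ∷ᵛ P) i ≢ (xs ∷ᵛ P) j × (∀ z → z ∈ (xs ∷ᵛ P) i → ¬ z ∈ (xs ∷ᵛ P) j)
    distinct zero    zero    0≢0 = ⊥-elim (0≢0 refl)
    distinct zero    (suc j) _   = xs≢P j , λ _ z∈xs z∈Pj → xs#P j (z∈xs , z∈Pj)
    distinct (suc i) zero    _   = xs≢P i ∘ sym , λ _ z∈Pi z∈xs → xs#P i (z∈xs , z∈Pi)
    distinct (suc i) (suc j) i≢j = P# i j (i≢j ∘ cong suc)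

IsPath-mono : ∀ {G G′ : Graph n} → (∀ {a b} → Adj G a b → Adj G′ a b) →
              ∀ {u v xs} → IsPath G u v xs → IsPath G′ u v xs
IsPath-mono G⊆G′ (lk , uq) = Linked.map G⊆G′ lk , uq

Inseparable : ℕ → Graph n → Fin n → Fin n → Set
Inseparable {n} k G u v = ∀ (X : Subset n) → ∣ X ∣ < k → u ∉ₛ X → v ∉ₛ X → PathAvoiding G X u v

module NonAdjacent (G : Graph n) {u v : Fin n} (u≢v : u ≢ v) (u≁v : ¬ Adj G u v) where

  F : Subset n
  F = ⁅ u ⁆ ∪ ⁅ v ⁆

  u∈F : u ∈ₛ F
  u∈F = SubP.x∈p∪q⁺ (inj₁ (SubP.x∈⁅x⁆ u))

  v∈F : v ∈ₛ F
  v∈F = SubP.x∈p∪q⁺ (inj₂ (SubP.x∈⁅x⁆ v))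

  ∉F : ∀ {z} → z ≢ u → z ≢ v → z ∉ₛ F
  ∉F z≢u z≢v z∈F with SubP.x∈p∪q⁻ ⁅ u ⁆ ⁅ v ⁆ z∈F
  ... | inj₁ z∈⁅u⁆ = z≢u (SubP.x∈⁅y⁆⇒x≡y u z∈⁅u⁆)
  ... | inj₂ z∈⁅v⁆ = z≢v (SubP.x∈⁅y⁆⇒x≡y v z∈⁅v⁆)

  -- Edges of G - u - v; constraining only the tail of an edge lets the last edge of a u-v path enter v.
  E : Fin n → Fin n → Set
  E a b = Adj G a b × a ∉ₛ F

  B : Subset n
  B = Nbr G v

  open Menger E (Nbr G u)

  walk-∉F : ∀ {s t} (w : Walk E s t) → t ∉ₛ F → All (_∉ₛ F) (verts w)
  walk-∉F [ x ]                  x∉F = x∉F ∷ []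
  walk-∉F (x ∷⟨ _ , x∉F ⟩ w) t∉F = x∉F ∷ walk-∉F w t∉F

  ∈B⇒∉F : ∀ {z} → z ∈ₛ B → z ∉ₛ F
  ∈B⇒∉F z∈B = ∉F (λ { refl → u≁v (trans (adj-sym G u v) (∈Nbr⁻ G z∈B)) })
                  (λ { refl → Adj-irrefl G (∈Nbr⁻ G z∈B) })

  ABPath-∉F : ∀ (P : ABPath B) → All (_∉ₛ F) (Vₐ P)
  ABPath-∉F P = walk-∉F (walk (path P)) (∈B⇒∉F (end∈B (path P)))

  toIsPath : ∀ (P : ABPath B) → IsPath G u v (Vₐ P)
  toIsPath P = linked-between proj₁ (∈Nbr⁻ G (start∈A P)) (walk (path P))
                 (trans (adj-sym G _ v) (∈Nbr⁻ G (end∈B (path P)))) , u∉ ∷ Unique.++⁺ (unique (path P)) ([] ∷ []) P#v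
    where
    u∉ : All (u ≢_) (Vₐ P ++ v ∷ [])
    u∉ = Allₚ.++⁺ (All.map (λ z∉F u≡z → z∉F (subst (_∈ₛ F) u≡z u∈F)) (ABPath-∉F P)) (u≢v ∷ [])
    P#v : Disjoint (Vₐ P) (v ∷ [])
    P#v (z∈P , here refl) = All.lookup (ABPath-∉F P) z∈P v∈F

  -- Cut a u-v path avoiding X ─ F at its first vertex in B, dropping u.
  noSeparator : ∀ {k} → Inseparable k G u v → NoSeparator k B
  noSeparator insep X ∣X∣<k with insep (X ─ F) (≤-<-trans (SubP.∣p─q∣≤∣p∣ X F) ∣X∣<k)
                                   (λ u∈ → x∈p─q⇒x∉q u∈ u∈F) (λ v∈ → x∈p─q⇒x∉q v∈ v∈F)
  ... | [] , (u~v ∷ _ , _) , _ = ⊥-elim (u≁v u~v)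
  ... | a ∷ xs , (u~a ∷ lk , uaxs!@(_ ∷ axs!)) , axs∉
    with Unique-between (a ∷ xs) uaxs!
  ...   | axs≢uv with fromLinked xs (Linked-sources (a ∷ xs) lk (All.map (λ (z≢u , z≢v) → ∉F z≢u z≢v) axs≢uv))
  ...     | w , w≡ with penultimate w (proj₂ (All.lookup axs≢uv (here refl)))
  ...       | b , b∈w , b~v with truncate w (subst Unique (sym w≡) axs!) b∈w (∈Nbr⁺ G (trans (adj-sym G v b) (proj₁ b~v)))
  ...         | T , T⊆w = record { start∈A = ∈Nbr⁺ G u~a ; path = T } , All.tabulate avoids
    where
    avoids : ∀ {z} → z ∈ V T → z ∉ₛ X
    avoids {z} z∈T z∈X with ∈-++⁻ (a ∷ xs) (subst (z ∈_) w≡ (T⊆w z∈T))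
    ... | inj₁ z∈axs       = let z≢u , z≢v = All.lookup axs≢uv z∈axs in
                             All.lookup axs∉ z∈axs (SubP.x∈p∧x∉q⇒x∈p─q z∈X (∉F z≢u z≢v))
    ... | inj₂ (here refl) = All.lookup (ABPath-∉F (record { start∈A = ∈Nbr⁺ G u~a ; path = T })) z∈T v∈F

  paths : ∀ {k} → Inseparable k G u v → HasDisjointPaths G k u v
  paths insep with menger (noSeparator insep)
  ... | P , P# = Vₐ ∘ P , toIsPath ∘ P , λ i j i≢j →
    (λ Pi≡Pj → P# i j i≢j (start∈ (walk (path (P i))) , subst (_ ∈_) Pi≡Pj (start∈ (walk (path (P i)))))) ,
    λ z z∈Pi z∈Pj → P# i j i≢j (z∈Pi , z∈Pj)

module _ {G : Graph n} {u v : Fin n} where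

  -- A path avoiding one end c of the edge uv cannot use that edge.
  avoiding-leg : ∀ {X c a b} → c ≡ u ⊎ c ≡ v → a ≢ c → b ≢ c → PathAvoiding G (X ∪ ⁅ c ⁆) a b →
                 Σ (Walk (Adj (deleteEdge G u v)) a b) λ w → All (λ z → z ≡ a ⊎ z ≡ b ⊎ z ∉ₛ X) (verts w)
  avoiding-leg {X} {c} {a} {b} c∈uv a≢c b≢c path with PathAvoiding⇒walk G path
  ... | w , _ , kinds = proj₁ leg , subst (All Kind) (sym (proj₂ leg)) (All.map weaken kinds)
    where
    Kind : Fin n → Set
    Kind z = z ≡ a ⊎ z ≡ b ⊎ z ∉ₛ X
    ≢c : ∀ {z} → z ≡ a ⊎ z ≡ b ⊎ z ∉ₛ X ∪ ⁅ c ⁆ → z ≢ c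
    ≢c (inj₁ refl)        = a≢c
    ≢c (inj₂ (inj₁ refl)) = b≢c
    ≢c (inj₂ (inj₂ z∉))   = proj₂ (x∉p∪⁅y⁆⁻ z∉)
    weaken : ∀ {z} → z ≡ a ⊎ z ≡ b ⊎ z ∉ₛ X ∪ ⁅ c ⁆ → Kind z
    weaken (inj₁ z≡a)        = inj₁ z≡a
    weaken (inj₂ (inj₁ z≡b)) = inj₂ (inj₁ z≡b)
    weaken (inj₂ (inj₂ z∉))  = inj₂ (inj₂ (proj₁ (x∉p∪⁅y⁆⁻ z∉)))
    keep : c ≡ u ⊎ c ≡ v → ∀ {p q} → p ≢ c → q ≢ c → Adj G p q → Adj (deleteEdge G u v) p q
    keep (inj₁ refl) p≢c q≢c p~q = deleteEdge-keeps G p~q (p≢c ∘ proj₁) (q≢c ∘ proj₂)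
    keep (inj₂ refl) p≢c q≢c p~q = deleteEdge-keeps G p~q (q≢c ∘ proj₂) (p≢c ∘ proj₁)
    leg : Σ (Walk (Adj (deleteEdge G u v)) a b) λ w′ → verts w′ ≡ verts w
    leg = restrictʷ (keep c∈uv) w (All.map ≢c kinds)

  -- Route through a third vertex h: from u to h avoiding v, then from h to v avoiding u.
  via-hub : ∀ {k X h} → KConnected (suc k) G → ∣ X ∣ < k → u ≢ v → u ∉ₛ X → v ∉ₛ X →
            h ∉ₛ X → h ≢ u → h ≢ v → PathAvoiding (deleteEdge G u v) X u v
  via-hub {k} {X} {h} (_ , connected) ∣X∣<k u≢v u∉X v∉X h∉X h≢u h≢v with
    avoiding-leg (inj₂ refl) u≢v h≢v
      (connected (X ∪ ⁅ v ⁆) (∣p∣<n⇒∣p∪⁅x⁆∣<1+n X v ∣X∣<k) u h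
                 (x∉p∪⁅y⁆ u∉X u≢v) (x∉p∪⁅y⁆ h∉X h≢v) (h≢u ∘ sym))
    | avoiding-leg (inj₁ refl) h≢u (u≢v ∘ sym)
      (connected (X ∪ ⁅ u ⁆) (∣p∣<n⇒∣p∪⁅x⁆∣<1+n X u ∣X∣<k) h v
                 (x∉p∪⁅y⁆ h∉X h≢u) (x∉p∪⁅y⁆ v∉X (u≢v ∘ sym)) h≢v)
  ... | w₁ , kinds₁ | w₂ , kinds₂ = walk⇒PathAvoiding (deleteEdge G u v) (w₁ ++ʷ w₂) u≢v avoids
    where
    avoids : ∀ {z} → z ∈ verts (w₁ ++ʷ w₂) → z ≢ u → z ≢ v → z ∉ₛ X
    avoids z∈ z≢u z≢v =
      [ (λ z∈₁ → first (All.lookup kinds₁ z∈₁)) , (λ z∈₂ → second (All.lookup kinds₂ z∈₂)) ]′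
                          (∈-++ʷ⁻ w₁ w₂ z∈)
      where
      first : _ ≡ u ⊎ _ ≡ h ⊎ _ ∉ₛ X → _ ∉ₛ X
      first (inj₁ z≡u)        = ⊥-elim (z≢u z≡u)
      first (inj₂ (inj₁ refl)) = h∉X
      first (inj₂ (inj₂ z∉X)) = z∉X
      second : _ ≡ h ⊎ _ ≡ v ⊎ _ ∉ₛ X → _ ∉ₛ X
      second (inj₁ refl)       = h∉X
      second (inj₂ (inj₁ z≡v)) = ⊥-elim (z≢v z≡v)
      second (inj₂ (inj₂ z∉X)) = z∉X

  Inseparable-deleteEdge : ∀ {k} → KConnected (suc k) G → u ≢ v → Inseparable k (deleteEdge G u v) u v
  Inseparable-deleteEdge {k} kc@(k+1<n , _) u≢v X ∣X∣<k u∉X v∉X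
    with ∃∉ ((X ∪ ⁅ u ⁆) ∪ ⁅ v ⁆)
            (<-≤-trans (∣p∣<n⇒∣p∪⁅x⁆∣<1+n (X ∪ ⁅ u ⁆) v (∣p∣<n⇒∣p∪⁅x⁆∣<1+n X u ∣X∣<k)) k+1<n)
  ... | h , h∉ with x∉p∪⁅y⁆⁻ h∉
  ...   | h∉X∪u , h≢v with x∉p∪⁅y⁆⁻ h∉X∪u
  ...     | h∉X , h≢u = via-hub kc ∣X∣<k u≢v u∉X v∉X h∉X h≢u h≢v

addEdge : ∀ (G : Graph n) {k u v} → Adj G u v → u ≢ v → HasDisjointPaths (deleteEdge G u v) k u v →
          HasDisjointPaths G (suc k) u v
addEdge G {u = u} {v} u~v u≢v (P , P-path , P#) =
  extend G {xs = []} (P , (λ i → IsPath-mono {G = deleteEdge G u v} {G} (deleteEdge-⊆ G {u} {v}) (P-path i)) , P#)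
    (edge-IsPath G u~v u≢v) nonempty λ { _ (() , _) }
  where
  nonempty : ∀ i → [] ≢ P i
  nonempty i []≡Pi = deleteEdge-removes G
    (IsPath[]⇒Adj (deleteEdge G u v) (subst (IsPath (deleteEdge G u v) u v) (sym []≡Pi) (P-path i)))

disjointPaths : ∀ {k} {G : Graph n} → KConnected k G → ∀ {u v} → u ≢ v → HasDisjointPaths G k u v
disjointPaths {k = zero}  _  _ = (λ ()) , (λ ()) , λ ()
disjointPaths {k = suc k} {G} kc {u} {v} u≢v with adj G u v ≟ᵇ true
... | yes u~v = addEdge G u~v u≢v (NonAdjacent.paths (deleteEdge G u v) u≢v (deleteEdge-removes G)
                                   (Inseparable-deleteEdge {G = G} kc u≢v))
... | no u≁v  = NonAdjacent.paths G u≢v u≁v λ X ∣X∣<k u∉X v∉X → proj₂ kc X ∣X∣<k u v u∉X v∉X u≢v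

-- Uniformly, super-minimally and minimally k-connected graphs

module _ {G : Graph n} (S : Subgraph G) where

  private
    φ : Fin (m S) → Fin n
    φ = f S

  Image : Fin n → Set
  Image y = ∃ λ x → φ x ≡ y

  Image? : Decidable Image
  Image? y = any? λ x → φ x ≟ᶠ y

  Image⇒Surjective : (∀ y → Image y) → Surjective _≡_ _≡_ φ
  Image⇒Surjective im y = proj₁ (im y) , λ { refl → proj₂ (im y) }

  map-IsPath : ∀ {a b xs} → IsPath (H S) a b xs → IsPath G (φ a) (φ b) (map φ xs)
  map-IsPath {a} {b} {xs} (lk , uq) =
    subst (λ ys → Linked (Adj G) (φ a ∷ ys)) (map-++ φ xs (b ∷ [])) (Linkedₚ.map⁺ (Linked.map (f-edges S _ _) lk)) ,
    subst (λ ys → Unique (φ a ∷ ys)) (map-++ φ xs (b ∷ [])) (Unique.map⁺ (f-inj S) uq)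

  map-HasDisjointPaths : ∀ {a b} → HasDisjointPaths (H S) k a b → HasDisjointPaths G k (φ a) (φ b)
  map-HasDisjointPaths (P , P-path , P#) = map φ ∘ P , map-IsPath ∘ P-path , λ i j i≢j →
    (λ Pi≡Pj → proj₁ (P# i j i≢j) (map-injective (f-inj S) Pi≡Pj)) , disjoint i j i≢j
    where
    disjoint : ∀ i j → i ≢ j → ∀ z → z ∈ map φ (P i) → ¬ z ∈ map φ (P j)
    disjoint i j i≢j z z∈i z∈j with ∈-map⁻ φ z∈i | ∈-map⁻ φ z∈j
    ... | x , x∈ , refl | y , y∈ , fx≡fy = proj₂ (P# i j i≢j) x x∈ (subst (_∈ P j) (sym (f-inj S fx≡fy)) y∈)

  map≡off-image⇒[] : ∀ {xs} ys → All (¬_ ∘ Image) xs → xs ≡ map φ ys → ys ≡ []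
  map≡off-image⇒[] []       _         _    = refl
  map≡off-image⇒[] (y ∷ ys) (z∉ ∷ _) refl = ⊥-elim (z∉ (y , refl))

  -- Together with the k paths of H, mapped into G, such a path would be a (k+1)-st one.
  no-extra-path : UniformlyKConnected k G → KConnected k (H S) → ∀ {a b xs} → a ≢ b →
                  IsPath G (φ a) (φ b) xs → All (¬_ ∘ Image) xs → (xs ≡ [] → ¬ Adj (H S) a b) → ⊥
  no-extra-path {k} (_ , exactly) kcH {a} {b} {xs} a≢b xs-path xs∉ ¬edge =
    proj₂ (exactly (φ a) (φ b) (a≢b ∘ f-inj S)) (extend G (map-HasDisjointPaths P) xs-path distinct disjoint)
    where
    P : HasDisjointPaths (H S) k a b
    P = disjointPaths {G = H S} kcH a≢b
    distinct : ∀ i → xs ≢ map φ (proj₁ P i)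
    distinct i xs≡Pi with map≡off-image⇒[] (proj₁ P i) xs∉ xs≡Pi
    ... | Pi≡[] = ¬edge (trans xs≡Pi (cong (map φ) Pi≡[]))
                        (IsPath[]⇒Adj (H S) (subst (IsPath (H S) a b) Pi≡[] (proj₁ (proj₂ P) i)))
    disjoint : ∀ i → Disjoint xs (map φ (proj₁ P i))
    disjoint i (z∈xs , z∈Pi) with ∈-map⁻ φ z∈Pi
    ... | x , _ , z≡φx = All.lookup xs∉ z∈xs (x , sym z≡φx)

  module _ (kc : KConnected k G) (2≤k : 2 ≤ k) where

    -- Opaque, as with-abstracting over these results would otherwise unfold them.
    opaque
      off-image-neighbour : ∀ {y} → 0 < m S → ¬ Image y → ∃ λ z → ¬ Image z × ∃ λ a → Adj G (φ a) z
      off-image-neighbour {y} 0<m ¬y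
        with PathAvoiding⇒walk G (proj₂ kc ∅ (subst (_< k) (sym (SubP.∣⊥∣≡0 n)) (<-≤-trans (s≤s z≤n) 2≤k))
                                   y (φ (fromℕ< 0<m)) SubP.∉⊥ SubP.∉⊥ (λ y≡φa₀ → ¬y (fromℕ< 0<m , sym y≡φa₀)))
      ... | w , w! , _ with firstHit Image? w w! (end∈ w) (fromℕ< 0<m , refl)
      ...   | t , sp , (a , φa≡t) , first with penultimate (Split.prefix sp) (λ y≡t → ¬y (a , trans φa≡t (sym y≡t)))
      ...     | z , z∈ , z~t = z , (λ im → Adj-irrefl G (subst (λ x → Adj G x t) (first z∈ im) z~t)) ,
                               a , subst (λ x → Adj G x z) (sym φa≡t) (trans (adj-sym G t z) z~t)

      ear : ∀ {z a} → 1 < m S → ¬ Image z → Adj G (φ a) z →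
            ∃ λ b → a ≢ b × ∃ λ xs → IsPath G (φ a) (φ b) xs × All (¬_ ∘ Image) xs × xs ≢ []
      ear {z} {a} 1<m ¬z φa~z with ∃∉ ⁅ a ⁆ (subst (_< m S) (sym (SubP.∣⁅x⁆∣≡1 a)) 1<m)
      ... | b′ , b′∉ with PathAvoiding⇒walk G (proj₂ kc ⁅ φ a ⁆ (subst (_< k) (sym (SubP.∣⁅x⁆∣≡1 (φ a))) 2≤k)
                                                  z (φ b′) z∉ b′∉⁅φa⁆ (λ z≡φb′ → ¬z (b′ , sym z≡φb′)))
        where
        z∉ : z ∉ₛ ⁅ φ a ⁆
        z∉ z∈ = ¬z (a , sym (SubP.x∈⁅y⁆⇒x≡y (φ a) z∈))
        b′∉⁅φa⁆ : φ b′ ∉ₛ ⁅ φ a ⁆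
        b′∉⁅φa⁆ φb′∈ =
          b′∉ (subst (_∈ₛ ⁅ a ⁆) (sym (f-inj S (SubP.x∈⁅y⁆⇒x≡y (φ a) φb′∈))) (SubP.x∈⁅x⁆ a))
      ... | w , w! , kinds with firstHit Image? w w! (end∈ w) (b′ , refl)
      ...   | t′ , sp , (b , φb≡t′) , first =
        b , a≢b , body r , subst (λ t → IsPath G (φ a) t (body r)) (sym φb≡t′) path ,
        All.tabulate off-image , body≢[] r (λ z≡t′ → ¬z (b , trans φb≡t′ (sym z≡t′)))
        where
        open Split sp renaming (prefix to r)
        ≢φa : ∀ {x} → x ∈ verts r → x ≢ φ a
        ≢φa x∈ x≡φa with All.lookup kinds (prefix⊆ x∈)
        ... | inj₁ x≡z          = ¬z (a , trans (sym x≡φa) x≡z)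
        ... | inj₂ (inj₁ x≡φb′) =
          b′∉ (subst (_∈ₛ ⁅ a ⁆) (f-inj S (trans (sym x≡φa) x≡φb′)) (SubP.x∈⁅x⁆ a))
        ... | inj₂ (inj₂ x∉)    = x∉ (subst (_∈ₛ ⁅ φ a ⁆) (sym x≡φa) (SubP.x∈⁅x⁆ (φ a)))
        ear-walk : Walk (Adj G) (φ a) t′
        ear-walk = φ a ∷⟨ φa~z ⟩ r
        ear! : Unique (verts ear-walk)
        ear! = All.tabulate (λ x∈ φa≡x → ≢φa x∈ (sym φa≡x)) ∷ prefix!
        φa≢t′ : φ a ≢ t′
        φa≢t′ φa≡t′ = ≢φa (end∈ r) (sym φa≡t′)
        a≢b : a ≢ b
        a≢b a≡b = φa≢t′ (trans (cong φ a≡b) φb≡t′)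
        path : IsPath G (φ a) t′ (body r)
        path = walk⇒IsPath G ear-walk φa≢t′ ear!
        off-image : ∀ {x} → x ∈ body r → ¬ Image x
        off-image x∈ im = proj₂ (interior-∉ends G ear-walk ear! x∈) (first (∈-++⁺ˡ x∈) im)

  module _ (uniform : UniformlyKConnected k G) (2≤k : 2 ≤ k) (kcH : KConnected k (H S)) where

    private
      1<m : 1 < m S
      1<m = Data.Nat.Properties.≤-trans 2≤k (Data.Nat.Properties.<⇒≤ (proj₁ kcH))

    every-vertex-in-image : ∀ y → Image y
    every-vertex-in-image y with Image? y
    ... | yes y∈ = y∈
    ... | no ¬y = ⊥-elim (no-ear (off-image-neighbour (proj₁ uniform) 2≤k (<-≤-trans (s≤s z≤n) 1<m) ¬y))
      where
      no-ear : (∃ λ z → ¬ Image z × ∃ λ a → Adj G (φ a) z) → ⊥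
      no-ear (z , ¬z , a , φa~z) with ear (proj₁ uniform) 2≤k 1<m ¬z φa~z
      ... | b , a≢b , xs , path , xs∉ , xs≢[] = no-extra-path uniform kcH a≢b path xs∉ (⊥-elim ∘ xs≢[])

    reflects-edges : ∀ i j → Adj G (φ i) (φ j) → Adj (H S) i j
    reflects-edges i j φi~φj with adj (H S) i j ≟ᵇ true
    ... | yes i~j = i~j
    ... | no  i≁j = ⊥-elim (no-extra-path uniform kcH (φi≢φj ∘ cong φ) (edge-IsPath G φi~φj φi≢φj) [] λ _ → i≁j)
      where
      φi≢φj : φ i ≢ φ j
      φi≢φj φi≡φj = Adj-irrefl G (subst (λ x → Adj G x (φ j)) φi≡φj φi~φj)

uniform⇒superMinimal : ∀ {G : Graph n} → 2 ≤ k → UniformlyKConnected k G → SuperMinimallyKConnected k G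
uniform⇒superMinimal 2≤k uniform = proj₁ uniform , λ S proper kcH → proper
  (Image⇒Surjective S (every-vertex-in-image S uniform 2≤k kcH) , reflects-edges S uniform 2≤k kcH)

deleteEdge-subgraph : ∀ (G : Graph n) u v → Subgraph G
deleteEdge-subgraph {n} G u v = record
  { m = n ; H = deleteEdge G u v ; f = λ x → x ; f-inj = λ x≡y → x≡y ; f-edges = λ _ _ → deleteEdge-⊆ G }

superMinimal⇒minimal : ∀ {G : Graph n} → SuperMinimallyKConnected k G → MinimallyKConnected k G
superMinimal⇒minimal {G = G} (kc , minimal) = kc , λ u v u~v kc′ →
  minimal (deleteEdge-subgraph G u v) (λ (_ , reflects) → deleteEdge-removes G (reflects u v u~v)) kc′

-- Minimum degree, saturation and connectivity through a hub

neighbour-outside : ∀ {G : Graph n} → KConnected k G → ∀ {S u} → ∣ S ∣ < k → u ∉ₛ S →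
                    ∃ λ w → Adj G u w × w ∉ₛ S
neighbour-outside (k<n , connected) {S} {u} ∣S∣<k u∉S
  with ∃∉ (S ∪ ⁅ u ⁆) (≤-<-trans (∣p∪⁅x⁆∣≤1+∣p∣ S u) (<-≤-trans (s≤s ∣S∣<k) k<n))
... | w , w∉ with x∉p∪⁅y⁆⁻ w∉
...   | w∉S , w≢u with connected S ∣S∣<k u w u∉S w∉S (w≢u ∘ sym)
...     | []    , (u~w ∷ _ , _) , _         = w , u~w , w∉S
...     | x ∷ _ , (u~x ∷ _ , _) , x∉S ∷ _ = x , u~x , x∉S

module _ {E : Fin n → Fin n → Set} (E-sym : ∀ {a b} → E a b → E b a) where

  reverseʷ : ∀ {s t} → Walk E s t → Walk E t s
  reverseʷ [ x ]          = [ x ]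
  reverseʷ (x ∷⟨ e ⟩ w) = reverseʷ w ++ʷ (_ ∷⟨ E-sym e ⟩ [ x ])

  ∈-reverseʷ : ∀ {s t} (w : Walk E s t) {z} → z ∈ verts (reverseʷ w) → z ∈ verts w
  ∈-reverseʷ [ x ]          z∈ = z∈
  ∈-reverseʷ (x ∷⟨ e ⟩ w) z∈ with ∈-++ʷ⁻ (reverseʷ w) (_ ∷⟨ E-sym e ⟩ [ x ]) z∈
  ... | inj₁ z∈w                = there (∈-reverseʷ w z∈w)
  ... | inj₂ (here refl)        = there (start∈ w)
  ... | inj₂ (there (here refl)) = here refl

record Reach (G : Graph n) (S : Subset n) (a b : Fin n) : Set where
  constructor reaching
  field
    route  : Walk (Adj G) a b
    avoids : All (_∉ₛ S) (verts route)

module _ {G : Graph n} {S : Subset n} where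

  reach-edge : ∀ {a b} → Adj G a b → a ∉ₛ S → b ∉ₛ S → Reach G S a b
  reach-edge a~b a∉ b∉ = reaching (_ ∷⟨ a~b ⟩ [ _ ]) (a∉ ∷ b∉ ∷ [])

  infixr 5 _⨾_
  _⨾_ : ∀ {a b c} → Reach G S a b → Reach G S b c → Reach G S a c
  reaching w₁ w₁∉ ⨾ reaching w₂ w₂∉ =
    reaching (w₁ ++ʷ w₂) (All.tabulate λ z∈ → [ All.lookup w₁∉ , All.lookup w₂∉ ]′ (∈-++ʷ⁻ w₁ w₂ z∈))

  reach-sym : ∀ {a b} → Reach G S a b → Reach G S b a
  reach-sym (reaching w w∉) =
    reaching (reverseʷ (λ {a} {b} → trans (adj-sym G b a)) w) (All.tabulate (All.lookup w∉ ∘ ∈-reverseʷ _ w))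

KConnected-via-hub : ∀ {G : Graph n} → k < n →
                     (∀ S → ∣ S ∣ < k → ∃ λ hub → ∀ {v} → v ∉ₛ S → Reach G S v hub) → KConnected k G
KConnected-via-hub {G = G} k<n hubs = k<n , λ S ∣S∣<k u v u∉S v∉S u≢v →
  let hub , to-hub = hubs S ∣S∣<k
      reaching w w∉S = to-hub u∉S ⨾ reach-sym (to-hub v∉S)
  in walk⇒PathAvoiding G w u≢v λ z∈ _ _ → All.lookup w∉S z∈

common-neighbours : ∀ {G : Graph n} {q u v} (φ : Fin q → Fin n) → (∀ {i j} → φ i ≡ φ j → i ≡ j) →
                    (∀ i → Adj G u (φ i) × Adj G (φ i) v) → u ≢ v → HasDisjointPaths G q u v
common-neighbours {G = G} {u = u} {v} φ φ-inj links u≢v = (λ i → φ i ∷ []) , path , λ i j i≢j →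
  i≢j ∘ φ-inj ∘ ∷-injectiveˡ , λ { z (here refl) (here φi≡φj) → i≢j (φ-inj φi≡φj) }
  where
  path : ∀ i → IsPath G u v (φ i ∷ [])
  path i = let u~φi , φi~v = links i in
    u~φi ∷ φi~v ∷ [-] ,
    ((λ u≡φi → Adj-irrefl G (subst (Adj G u) (sym u≡φi) u~φi)) ∷ u≢v ∷ []) ∷
    ((λ φi≡v → Adj-irrefl G (subst (Adj G (φ i)) (sym φi≡v) φi~v)) ∷ []) ∷ [] ∷ []

-- H has minimum degree k, so i keeps every one of these at most k neighbours.
saturated : ∀ {G : Graph n} (S : Subgraph G) → KConnected k (H S) → ∀ i (N : List (Fin n)) → length N ≤ k →
            (∀ {y} → Adj G (f S i) y → y ∈ N) → ∀ {y} → Adj G (f S i) y → ∃ λ j → Adj (H S) i j × f S j ≡ y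
saturated S kcH i N ∣N∣≤k N⊇ {y} φi~y with ∣preimage∣≤∣p∣ (f S) (f-inj S) (setOf N - y)
... | T , ∣T∣≤∣N-y∣ , into-T
  with neighbour-outside {G = H S} kcH {S = T - i}
         (≤-<-trans (SubP.∣p─q∣≤∣p∣ T ⁅ i ⁆) (<-≤-trans (≤-<-trans ∣T∣≤∣N-y∣ (∣setOf-x∣<length N (N⊇ φi~y))) ∣N∣≤k))
         (λ i∈ → x∈p─q⇒x∉q i∈ (SubP.x∈⁅x⁆ i))
... | j , i~j , j∉T-i with f S j ≟ᶠ y
...   | yes φj≡y = j , i~j , φj≡y
...   | no  φj≢y = ⊥-elim (j∉T-i (SubP.x∈p∧x≢y⇒x∈p-y (into-T φj∈N-y) j≢i))
  where
  φj∈N-y : f S j ∈ₛ setOf N - y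
  φj∈N-y = SubP.x∈p∧x≢y⇒x∈p-y (∈-setOf⁺ (N⊇ (f-edges S i j i~j))) φj≢y
  j≢i : j ≢ i
  j≢i refl = Adj-irrefl (H S) i~j

_─from_ : Graph n → (Fin n → Set) → Fin n → Fin n → Set
(G ─from D) a b = Adj G a b × D a

-- Saturation spreads the image of a k-connected subgraph from one vertex of D over all of G.
superMinimal-criterion :
  ∀ {G : Graph n} → 1 ≤ k → KConnected k G → (D : Fin n → Set) →
  (∀ {d} → D d → Σ (List (Fin n)) λ N → length N ≤ k × (∀ {y} → Adj G d y → y ∈ N)) →
  (∀ {a b} → Adj G a b → D a ⊎ D b) →
  (hub : Fin n) → (∀ {d} → D d → Walk (G ─from D) d hub × Walk (G ─from D) hub d) →
  (∀ y → D y ⊎ ∃ λ d → D d × Adj G d y) →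
  SuperMinimallyKConnected k G
superMinimal-criterion {n} {k} {G} 1≤k kc D low cover hub walks dominated =
  kc , λ S proper kcH → proper (Image⇒Surjective S (in-image S kcH) , reflects S kcH)
  where
  module _ (S : Subgraph G) (kcH : KConnected k (H S)) where
    spread : ∀ {d y} → D d → Image S d → Adj G d y → Image S y
    spread Dd (i , refl) d~y =
      let N , ∣N∣≤k , N⊇ = low Dd ; j , _ , φj≡y = saturated S kcH i N ∣N∣≤k N⊇ d~y in j , φj≡y
    along : ∀ {a b} → Walk (G ─from D) a b → Image S a → Image S b
    along [ x ]                 im = im
    along (x ∷⟨ x~y , Dx ⟩ w) im = along w (spread Dx im x~y)
    seed : ∃ λ d → D d × Image S d
    seed with neighbour-outside {G = H S} kcH {S = ∅} {u = i₀} (subst (_< k) (sym (SubP.∣⊥∣≡0 (m S))) 1≤k) SubP.∉⊥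
      where i₀ = fromℕ< (<-≤-trans (s≤s z≤n) (proj₁ kcH))
    ... | j , i₀~j , _ with cover (f-edges S _ j i₀~j)
    ...   | inj₁ Dφi₀ = _ , Dφi₀ , _ , refl
    ...   | inj₂ Dφj  = _ , Dφj , j , refl
    hub-image : Image S hub
    hub-image = let d , Dd , im = seed in along (proj₁ (walks Dd)) im
    in-image : ∀ y → Image S y
    in-image y with dominated y
    ... | inj₁ Dy = along (proj₂ (walks Dy)) hub-image
    ... | inj₂ (d , Dd , d~y) = spread Dd (along (proj₂ (walks Dd)) hub-image) d~y
    reflects : ∀ i j → Adj G (f S i) (f S j) → Adj (H S) i j
    reflects i j φi~φj with cover φi~φj
    ... | inj₁ Dφi = let N , ∣N∣≤k , N⊇ = low Dφi ; j′ , i~j′ , φj′≡φj = saturated S kcH i N ∣N∣≤k N⊇ φi~φj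
                     in subst (Adj (H S) i) (f-inj S φj′≡φj) i~j′
    ... | inj₂ Dφj = let N , ∣N∣≤k , N⊇ = low Dφj
                         i′ , j~i′ , φi′≡φi = saturated S kcH j N ∣N∣≤k N⊇ (trans (adj-sym G (f S j) (f S i)) φi~φj)
                     in trans (adj-sym (H S) i j) (subst (Adj (H S) j) (f-inj S φi′≡φi) j~i′)

-- Deleting the edge cd leaves c with fewer than k neighbours.
edge-at-low-degree-critical :
  ∀ {G : Graph n} {u v c d} → KConnected k (deleteEdge G u v) → ¬ Adj (deleteEdge G u v) c d →
  (N : List (Fin n)) → length N ≤ k → c ∉ N → (∀ {w} → Adj G c w → w ∈ N) → Adj G c d → ⊥
edge-at-low-degree-critical {G = G} {u} {v} {c} {d} kc′ c≁′d N ∣N∣≤k c∉N N⊇ c~d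
  with neighbour-outside {G = deleteEdge G u v} kc′ {S = setOf N - d} {u = c}
         (<-≤-trans (∣setOf-x∣<length N (N⊇ c~d)) ∣N∣≤k) (c∉N ∘ ∈-setOf⁻ N ∘ SubP.p─q⊆p _ _)
... | w , c~′w , w∉ with w ≟ᶠ d
...   | yes refl = c≁′d c~′w
...   | no  w≢d  = w∉ (SubP.x∈p∧x≢y⇒x∈p-y (∈-setOf⁺ (N⊇ (deleteEdge-⊆ G c~′w))) w≢d)

-- The examples

-- A graph on Fin N presented by a vertex type C, listing each edge in one direction only.
module Coded {C : Set} {N : ℕ} (code : C ↔ Fin N) (edge : C → C → Bool) (edge-irr : ∀ a → edge a a ≡ false) where

  adjC : C → C → Bool
  adjC a b = edge a b ∨ edge b a

  -- Opaque, so that ⌜ a ⌝ stays rigid and a can be inferred from it.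
  opaque
    ⌜_⌝ : C → Fin N
    ⌜_⌝ = Inverse.to code

    decode : Fin N → C
    decode = Inverse.from code

    decode-⌜⌝ : ∀ c → decode ⌜ c ⌝ ≡ c
    decode-⌜⌝ = Inverse.strictlyInverseʳ code

    ⌜⌝-decode : ∀ i → ⌜ decode i ⌝ ≡ i
    ⌜⌝-decode = Inverse.strictlyInverseˡ code

  graph : Graph N
  graph = record
    { adj = λ i j → adjC (decode i) (decode j)
    ; adj-sym = λ i j → ∨-comm (edge (decode i) (decode j)) (edge (decode j) (decode i))
    ; adj-irr = λ i → cong₂ _∨_ (edge-irr (decode i)) (edge-irr (decode i)) }

  ⌜⌝-injective : ∀ {a b} → ⌜ a ⌝ ≡ ⌜ b ⌝ → a ≡ b
  ⌜⌝-injective {a} {b} ⌜a⌝≡⌜b⌝ = trans (sym (decode-⌜⌝ a)) (trans (cong decode ⌜a⌝≡⌜b⌝) (decode-⌜⌝ b))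

  adj⁺ : ∀ a b → adjC a b ≡ true → Adj graph ⌜ a ⌝ ⌜ b ⌝
  adj⁺ a b = subst₂ (λ a′ b′ → adjC a′ b′ ≡ true) (sym (decode-⌜⌝ a)) (sym (decode-⌜⌝ b))

  adj⁻ : ∀ {a b} → Adj graph ⌜ a ⌝ ⌜ b ⌝ → adjC a b ≡ true
  adj⁻ {a} {b} = subst₂ (λ a′ b′ → adjC a′ b′ ≡ true) (decode-⌜⌝ a) (decode-⌜⌝ b)

  non-adj : ∀ {a b} → adjC a b ≡ false → ¬ Adj graph ⌜ a ⌝ ⌜ b ⌝
  non-adj a≁b a~b with trans (sym a≁b) (adj⁻ a~b)
  ... | ()

  decode-injective : ∀ {i j} → decode i ≡ decode j → i ≡ j
  decode-injective {i} {j} di≡dj = trans (sym (⌜⌝-decode i)) (trans (cong ⌜_⌝ di≡dj) (⌜⌝-decode j))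

  by-code : ∀ {P : Fin N → Set} → (∀ c → P ⌜ c ⌝) → ∀ i → P i
  by-code {P} P⌜⌝ i = subst P (⌜⌝-decode i) (P⌜⌝ (decode i))

  opaque
    some-route : ∀ {q} (R : Fin q → List C) → PairwiseDisjoint R → ∀ {S : Subset N} → ∣ S ∣ < q →
                 ∃ λ i → All (λ v → ⌜ v ⌝ ∉ₛ S) (R i)
    some-route R R# {S} ∣S∣<q with some-avoids (map ⌜_⌝ ∘ R) coded# S ∣S∣<q
      where
      coded# : PairwiseDisjoint (map ⌜_⌝ ∘ R)
      coded# i j i≢j (z∈i , z∈j) with ∈-map⁻ ⌜_⌝ z∈i | ∈-map⁻ ⌜_⌝ z∈j
      ... | a , a∈ , refl | b , b∈ , eq = R# i j i≢j (a∈ , subst (_∈ R j) (sym (⌜⌝-injective eq)) b∈)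
    ... | i , avoids = i , Allₚ.map⁻ avoids

  ⌜⌝-distinct : ∀ {a b} → a ≢ b → ⌜ a ⌝ ≢ ⌜ b ⌝
  ⌜⌝-distinct a≢b = a≢b ∘ ⌜⌝-injective

module Bipartite (a b : ℕ) where

  Side : Set
  Side = Fin a ⊎ Fin b

  edge : Side → Side → Bool
  edge (inj₁ _) (inj₂ _) = true
  edge _        _        = false

  edge-irr : ∀ x → edge x x ≡ false
  edge-irr (inj₁ _) = refl
  edge-irr (inj₂ _) = refl

  open Coded (↔-sym +↔⊎) edge edge-irr public

  left : List (Fin (a + b))
  left = map (λ i → ⌜ inj₁ i ⌝) (allFin a)

  some-outside : ∀ {q} (φ : Fin q → Side) → (∀ {i j} → φ i ≡ φ j → i ≡ j) →
                 ∀ {S : Subset (a + b)} → ∣ S ∣ < q → ∃ λ i → ⌜ φ i ⌝ ∉ₛ S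
  some-outside φ φ-inj ∣S∣<q
    with some-route (λ i → φ i ∷ []) (λ { i j i≢j (here refl , here eq) → i≢j (φ-inj eq) }) ∣S∣<q
  ... | i , φi∉S ∷ [] = i , φi∉S

  -- Every surviving vertex reaches a surviving right vertex, directly or through a surviving left vertex.
  connected : ∀ {k} → 1 ≤ k → k ≤ a → k ≤ b → KConnected k graph
  connected {k} 1≤k k≤a k≤b =
    KConnected-via-hub (≤-trans (+-monoˡ-≤ k 1≤k) (+-mono-≤ k≤a k≤b)) λ S ∣S∣<k →
    let r , r∉S = some-outside inj₂ inj₂-injective (<-≤-trans ∣S∣<k k≤b)
        l , l∉S = some-outside inj₁ inj₁-injective (<-≤-trans ∣S∣<k k≤a)
        to-hub : ∀ x → ⌜ x ⌝ ∉ₛ S → Reach graph S ⌜ x ⌝ ⌜ inj₂ r ⌝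
        to-hub = λ { (inj₁ i) i∉S → reach-edge (adj⁺ (inj₁ i) (inj₂ r) refl) i∉S r∉S
                   ; (inj₂ j) j∉S → reach-edge (adj⁺ (inj₂ j) (inj₁ l) refl) j∉S l∉S ⨾
                                    reach-edge (adj⁺ (inj₁ l) (inj₂ r) refl) l∉S r∉S }
    in ⌜ inj₂ r ⌝ , λ {v} → by-code {P = λ v → v ∉ₛ S → Reach graph S v ⌜ inj₂ r ⌝} to-hub v

module _ (k : ℕ) where

  private
    module Big = Bipartite k (suc k)
    module Small = Bipartite k k

  K-minimal : 1 ≤ k → MinimallyKConnected k Big.graph
  K-minimal 1≤k = Big.connected 1≤k ≤-refl (n≤1+n k) , Big.by-code λ x → Big.by-code λ y → critical x y
    where
    ∣left∣≡k : length Big.left ≡ k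
    ∣left∣≡k = trans (length-map _ (allFin k)) (length-tabulate id)
    right∉left : ∀ j → Big.⌜ inj₂ j ⌝ ∉ Big.left
    right∉left j ∈left with ∈-map⁻ _ ∈left
    ... | i , _ , ⌜j⌝≡⌜i⌝ with Big.⌜⌝-injective ⌜j⌝≡⌜i⌝
    ...   | ()
    right-nbrs : ∀ j {w} → Adj Big.graph Big.⌜ inj₂ j ⌝ w → w ∈ Big.left
    right-nbrs j {w} = Big.by-code {P = λ w → Adj Big.graph Big.⌜ inj₂ j ⌝ w → w ∈ Big.left} (λ
      { (inj₁ i) _ → ∈-map⁺ _ (∈-allFin i)
      ; (inj₂ j′) j~j′ → ⊥-elim (Big.non-adj refl j~j′) }) w
    critical : ∀ x y → Adj Big.graph Big.⌜ x ⌝ Big.⌜ y ⌝ →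
               ¬ KConnected k (deleteEdge Big.graph Big.⌜ x ⌝ Big.⌜ y ⌝)
    critical (inj₁ i) (inj₂ j) i~j kc′ =
      edge-at-low-degree-critical {G = Big.graph} kc′ (deleteEdge-removes′ Big.graph) Big.left
        (≤-reflexive ∣left∣≡k) (right∉left j) (right-nbrs j) (trans (adj-sym Big.graph _ _) i~j)
    critical (inj₂ j) (inj₁ i) j~i kc′ =
      edge-at-low-degree-critical {G = Big.graph} kc′ (deleteEdge-removes Big.graph) Big.left
        (≤-reflexive ∣left∣≡k) (right∉left j) (right-nbrs j) j~i
    critical (inj₁ _) (inj₁ _) i~i′ = ⊥-elim (Big.non-adj refl i~i′)
    critical (inj₂ _) (inj₂ _) j~j′ = ⊥-elim (Big.non-adj refl j~j′)

  embed : Small.Side → Big.Side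
  embed (inj₁ i) = inj₁ i
  embed (inj₂ j) = inj₂ (inject₁ j)

  embed-injective : ∀ {x y} → embed x ≡ embed y → x ≡ y
  embed-injective {inj₁ _} {inj₁ _} refl = refl
  embed-injective {inj₂ _} {inj₂ _} eq   = cong inj₂ (inject₁-injective (inj₂-injective eq))

  embed-adj : ∀ x y → Big.adjC (embed x) (embed y) ≡ Small.adjC x y
  embed-adj (inj₁ _) (inj₁ _) = refl
  embed-adj (inj₁ _) (inj₂ _) = refl
  embed-adj (inj₂ _) (inj₁ _) = refl
  embed-adj (inj₂ _) (inj₂ _) = refl

  K-contains-Kkk : Subgraph Big.graph
  K-contains-Kkk = record
    { m = k + k ; H = Small.graph ; f = λ i → Big.⌜ embed (Small.decode i) ⌝
    ; f-inj = Small.decode-injective ∘ embed-injective ∘ Big.⌜⌝-injective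
    ; f-edges = λ i j i~j → Big.adj⁺ _ _ (trans (embed-adj (Small.decode i) (Small.decode j)) i~j) }

  -- The last right vertex of K(k, k+1) is not hit by the embedding of K(k, k).
  K-not-superMinimal : 1 ≤ k → ¬ SuperMinimallyKConnected k Big.graph
  K-not-superMinimal 1≤k (_ , no-proper) = no-proper K-contains-Kkk proper (Small.connected 1≤k ≤-refl ≤-refl)
    where
    proper : Proper K-contains-Kkk
    proper (surjective , _) with surjective Big.⌜ inj₂ (fromℕ k) ⌝
    ... | x , hits with Small.decode x | Big.⌜⌝-injective (hits refl)
    ...   | inj₁ _ | ()
    ...   | inj₂ j | eq = fromℕ≢inject₁ (sym (inj₂-injective eq))

-- Two adjacent centres c₁, c₂; c₁ is joined to the leaves ℓ₁ a and c₂ to the leaves ℓ₂ a; every leaf is joined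
-- to every outer vertex x c.  With p = k - 1 leaves per centre and p outer vertices, all vertices but the outer
-- ones have degree exactly k, while two outer vertices have 2p ≥ k + 1 common neighbours.
module DoubleStar (q : ℕ) where

  p : ℕ
  p = suc (suc q)

  Vertex : Set
  Vertex = Fin 2 ⊎ Fin p ⊎ Fin p ⊎ Fin p

  pattern c₁   = inj₁ zero
  pattern c₂   = inj₁ (suc zero)
  pattern ℓ₁ a = inj₂ (inj₁ a)
  pattern ℓ₂ a = inj₂ (inj₂ (inj₁ a))
  pattern x c  = inj₂ (inj₂ (inj₂ c))

  edge : Vertex → Vertex → Bool
  edge c₁     c₂     = true
  edge c₁     (ℓ₁ _) = true
  edge c₂     (ℓ₂ _) = true
  edge (ℓ₁ _) (x _)  = true
  edge (ℓ₂ _) (x _)  = true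
  edge _      _      = false

  edge-irr : ∀ v → edge v v ≡ false
  edge-irr c₁     = refl
  edge-irr c₂     = refl
  edge-irr (ℓ₁ _) = refl
  edge-irr (ℓ₂ _) = refl
  edge-irr (x _)  = refl

  code : Vertex ↔ Fin (2 + (p + (p + p)))
  code = ↔-sym (↔-trans +↔⊎ (↔-refl ⊎-↔ ↔-trans +↔⊎ (↔-refl ⊎-↔ +↔⊎)))

  open Coded code edge edge-irr public

  G : Graph (2 + (p + (p + p)))
  G = graph

  leaf : Fin (2 + p) → Vertex
  leaf zero          = ℓ₂ zero
  leaf (suc zero)    = ℓ₂ (suc zero)
  leaf (suc (suc a)) = ℓ₁ a

  leaf-injective : ∀ {i j} → leaf i ≡ leaf j → i ≡ j
  leaf-injective {zero}        {zero}        _    = refl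
  leaf-injective {zero}        {suc zero}    ()
  leaf-injective {zero}        {suc (suc _)} ()
  leaf-injective {suc zero}    {zero}        ()
  leaf-injective {suc zero}    {suc zero}    _    = refl
  leaf-injective {suc zero}    {suc (suc _)} ()
  leaf-injective {suc (suc _)} {zero}        ()
  leaf-injective {suc (suc _)} {suc zero}    ()
  leaf-injective {suc (suc a)} {suc (suc a)} refl = refl

  leaf~x : ∀ i c → adjC (leaf i) (x c) ≡ true
  leaf~x zero          _ = refl
  leaf~x (suc zero)    _ = refl
  leaf~x (suc (suc _)) _ = refl

  x~leaf : ∀ i c → adjC (x c) (leaf i) ≡ true
  x~leaf zero          _ = refl
  x~leaf (suc zero)    _ = refl
  x~leaf (suc (suc _)) _ = refl

  hop : ∀ {S} a b → adjC a b ≡ true → ⌜ a ⌝ ∉ₛ S → ⌜ b ⌝ ∉ₛ S → Reach G S ⌜ a ⌝ ⌜ b ⌝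
  hop a b a~b = reach-edge (adj⁺ a b a~b)

  outer-only : ∀ {S} → ∣ S ∣ < suc p → (∀ c → ⌜ x c ⌝ ∈ₛ S) →
               ∀ {v} → (∀ c → v ≢ x c) → ⌜ v ⌝ ∉ₛ S
  outer-only {S} ∣S∣<1+p outer⊆S {v} v≢x v∈S =
    <⇒≱ ∣S∣<1+p (subst (_≤ ∣ S ∣) length≡1+p (length≤∣p∣ S distinct (v∈S ∷ inS)))
    where
    outer : List (Fin _)
    outer = map (λ c → ⌜ x c ⌝) (allFin p)
    length≡1+p : length (⌜ v ⌝ ∷ outer) ≡ suc p
    length≡1+p = cong suc (trans (length-map _ (allFin p)) (length-tabulate id))
    distinct : Unique (⌜ v ⌝ ∷ outer)
    distinct = All.tabulate (λ ∈outer v≡ → let c , _ , eq = ∈-map⁻ _ ∈outer in v≢x c (⌜⌝-injective (trans v≡ eq)))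
             ∷ Unique.map⁺ (λ eq → x-injective (⌜⌝-injective eq)) (Unique.allFin⁺ p)
      where
      x-injective : ∀ {c d} → x c ≡ x d → c ≡ d
      x-injective refl = refl
    inS : All (_∈ₛ S) outer
    inS = Allₚ.map⁺ (Allₚ.tabulate⁺ outer⊆S)

  routes₁ routes₂ : Fin (suc p) → List Vertex
  routes₁ zero    = c₂ ∷ ℓ₂ zero ∷ []
  routes₁ (suc a) = ℓ₁ a ∷ []
  routes₂ zero    = c₁ ∷ ℓ₁ zero ∷ []
  routes₂ (suc a) = ℓ₂ a ∷ []

  routes₁# : PairwiseDisjoint routes₁
  routes₁# zero    zero    0≢0 _                          = 0≢0 refl
  routes₁# zero    (suc _) _   (here refl , here ())
  routes₁# zero    (suc _) _   (there (here refl) , here ())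
  routes₁# (suc _) zero    _   (here refl , here ())
  routes₁# (suc _) zero    _   (here refl , there (here ()))
  routes₁# (suc a) (suc b) a≢b (here refl , here refl)     = a≢b refl

  routes₂# : PairwiseDisjoint routes₂
  routes₂# zero    zero    0≢0 _                          = 0≢0 refl
  routes₂# zero    (suc _) _   (here refl , here ())
  routes₂# zero    (suc _) _   (there (here refl) , here ())
  routes₂# (suc _) zero    _   (here refl , here ())
  routes₂# (suc _) zero    _   (here refl , there (here ()))
  routes₂# (suc a) (suc b) a≢b (here refl , here refl)     = a≢b refl

  leaves# : PairwiseDisjoint (λ i → leaf i ∷ [])
  leaves# i j i≢j (here refl , here eq) = i≢j (leaf-injective eq)

  -- A surviving outer vertex is reached from every centre along one of its p + 1 disjoint routes.
  module OuterHub {S : Subset _} (∣S∣<1+p : ∣ S ∣ < suc p) {c₀} (x₀∉S : ⌜ x c₀ ⌝ ∉ₛ S) where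

    from-outer : ∀ c → ⌜ x c ⌝ ∉ₛ S → (∃ λ i → All (λ v → ⌜ v ⌝ ∉ₛ S) (leaf i ∷ [])) →
                 Reach G S ⌜ x c ⌝ ⌜ x c₀ ⌝
    from-outer c x∉S (i , leaf∉S ∷ []) =
      hop (x c) (leaf i) (x~leaf i c) x∉S leaf∉S ⨾ hop (leaf i) (x c₀) (leaf~x i c₀) leaf∉S x₀∉S

    from-c₁ : ⌜ c₁ ⌝ ∉ₛ S → (∃ λ i → All (λ v → ⌜ v ⌝ ∉ₛ S) (routes₁ i)) → Reach G S ⌜ c₁ ⌝ ⌜ x c₀ ⌝
    from-c₁ c₁∉S (zero , c₂∉S ∷ ℓ∉S ∷ []) =
      hop c₁ c₂ refl c₁∉S c₂∉S ⨾ hop c₂ (ℓ₂ zero) refl c₂∉S ℓ∉S ⨾ hop (ℓ₂ zero) (x c₀) refl ℓ∉S x₀∉S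
    from-c₁ c₁∉S (suc a , ℓ∉S ∷ []) = hop c₁ (ℓ₁ a) refl c₁∉S ℓ∉S ⨾ hop (ℓ₁ a) (x c₀) refl ℓ∉S x₀∉S

    from-c₂ : ⌜ c₂ ⌝ ∉ₛ S → (∃ λ i → All (λ v → ⌜ v ⌝ ∉ₛ S) (routes₂ i)) → Reach G S ⌜ c₂ ⌝ ⌜ x c₀ ⌝
    from-c₂ c₂∉S (zero , c₁∉S ∷ ℓ∉S ∷ []) =
      hop c₂ c₁ refl c₂∉S c₁∉S ⨾ hop c₁ (ℓ₁ zero) refl c₁∉S ℓ∉S ⨾ hop (ℓ₁ zero) (x c₀) refl ℓ∉S x₀∉S
    from-c₂ c₂∉S (suc a , ℓ∉S ∷ []) = hop c₂ (ℓ₂ a) refl c₂∉S ℓ∉S ⨾ hop (ℓ₂ a) (x c₀) refl ℓ∉S x₀∉S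

    to-hub : ∀ v → ⌜ v ⌝ ∉ₛ S → Reach G S ⌜ v ⌝ ⌜ x c₀ ⌝
    to-hub c₁     c₁∉S = from-c₁ c₁∉S (some-route routes₁ routes₁# ∣S∣<1+p)
    to-hub c₂     c₂∉S = from-c₂ c₂∉S (some-route routes₂ routes₂# ∣S∣<1+p)
    to-hub (ℓ₁ a) ℓ∉S  = hop (ℓ₁ a) (x c₀) refl ℓ∉S x₀∉S
    to-hub (ℓ₂ a) ℓ∉S  = hop (ℓ₂ a) (x c₀) refl ℓ∉S x₀∉S
    to-hub (x c)  x∉S  =
      from-outer c x∉S (some-route (λ i → leaf i ∷ []) leaves# (≤-<-trans (n≤1+n _) (s≤s ∣S∣<1+p)))

  -- Otherwise S consists of the outer vertices, and c₁ is the hub.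
  module CentreHub {S : Subset _} (∣S∣<1+p : ∣ S ∣ < suc p) (outer⊆S : ∀ c → ⌜ x c ⌝ ∈ₛ S) where

    c₁∉S : ⌜ c₁ ⌝ ∉ₛ S
    c₁∉S = outer-only ∣S∣<1+p outer⊆S λ _ ()

    c₂∉S : ⌜ c₂ ⌝ ∉ₛ S
    c₂∉S = outer-only ∣S∣<1+p outer⊆S λ _ ()

    to-hub : ∀ v → ⌜ v ⌝ ∉ₛ S → Reach G S ⌜ v ⌝ ⌜ c₁ ⌝
    to-hub c₁     _    = reaching [ _ ] (c₁∉S ∷ [])
    to-hub c₂     c₂∉S = hop c₂ c₁ refl c₂∉S c₁∉S
    to-hub (ℓ₁ a) ℓ∉S  = hop (ℓ₁ a) c₁ refl ℓ∉S c₁∉S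
    to-hub (ℓ₂ a) ℓ∉S  = hop (ℓ₂ a) c₂ refl ℓ∉S c₂∉S ⨾ hop c₂ c₁ refl c₂∉S c₁∉S
    to-hub (x c)  x∉S  = ⊥-elim (x∉S (outer⊆S c))

  connected : KConnected (suc p) G
  connected = KConnected-via-hub (s≤s (s≤s (m≤m+n p (p + p))))
                λ S ∣S∣<1+p → hub S ∣S∣<1+p (any? λ c → ¬? (⌜ x c ⌝ ∈? S))
    where
    hub : ∀ S → ∣ S ∣ < suc p → Dec (∃ λ c → ⌜ x c ⌝ ∉ₛ S) → ∃ λ h → ∀ {v} → v ∉ₛ S → Reach G S v h
    hub S ∣S∣<1+p (yes (c₀ , x₀∉S)) =
      ⌜ x c₀ ⌝ , λ {v} → by-code {P = λ v → v ∉ₛ S → Reach G S v ⌜ x c₀ ⌝} (OuterHub.to-hub ∣S∣<1+p x₀∉S) v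
    hub S ∣S∣<1+p (no none) =
      ⌜ c₁ ⌝ , λ {v} → by-code {P = λ v → v ∉ₛ S → Reach G S v ⌜ c₁ ⌝} (CentreHub.to-hub ∣S∣<1+p outer⊆S) v
      where
      outer⊆S : ∀ c → ⌜ x c ⌝ ∈ₛ S
      outer⊆S c = decidable-stable (⌜ x c ⌝ ∈? S) (λ x∉S → none (c , x∉S))

  -- p + 2 of the leaves are common neighbours of the outer vertices x 0 and x 1.
  not-uniform : ¬ UniformlyKConnected (suc p) G
  not-uniform (_ , exactly) = proj₂ (exactly ⌜ x zero ⌝ ⌜ x (suc zero) ⌝ (⌜⌝-distinct λ ()))
    (common-neighbours {G = G} φ φ-injective links (⌜⌝-distinct λ ()))
    where
    φ : Fin (2 + p) → Fin _
    φ i = ⌜ leaf i ⌝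
    φ-injective : ∀ {i j} → φ i ≡ φ j → i ≡ j
    φ-injective = leaf-injective ∘ ⌜⌝-injective
    links : ∀ i → Adj G ⌜ x zero ⌝ (φ i) × Adj G (φ i) ⌜ x (suc zero) ⌝
    links zero          = adj⁺ _ _ refl , adj⁺ _ _ refl
    links (suc zero)    = adj⁺ _ _ refl , adj⁺ _ _ refl
    links (suc (suc a)) = adj⁺ _ _ refl , adj⁺ _ _ refl

  Central : Vertex → Set
  Central (x _) = ⊥
  Central _     = ⊤

  central-nbrs : ∀ v → Central v → List Vertex
  central-nbrs c₁     _ = c₂ ∷ map (λ a → ℓ₁ a) (allFin p)
  central-nbrs c₂     _ = c₁ ∷ map (λ a → ℓ₂ a) (allFin p)
  central-nbrs (ℓ₁ _) _ = c₁ ∷ map (λ c → x c) (allFin p)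
  central-nbrs (ℓ₂ _) _ = c₂ ∷ map (λ c → x c) (allFin p)

  length-central-nbrs : ∀ v (cv : Central v) → length (central-nbrs v cv) ≡ suc p
  length-central-nbrs c₁     _ = cong suc (trans (length-map _ (allFin p)) (length-tabulate id))
  length-central-nbrs c₂     _ = cong suc (trans (length-map _ (allFin p)) (length-tabulate id))
  length-central-nbrs (ℓ₁ _) _ = cong suc (trans (length-map _ (allFin p)) (length-tabulate id))
  length-central-nbrs (ℓ₂ _) _ = cong suc (trans (length-map _ (allFin p)) (length-tabulate id))

  central-nbrs-complete : ∀ v (cv : Central v) w → adjC v w ≡ true → w ∈ central-nbrs v cv
  central-nbrs-complete c₁     _ c₁     ()
  central-nbrs-complete c₁     _ c₂     _  = here refl
  central-nbrs-complete c₁     _ (ℓ₁ a) _  = there (∈-map⁺ _ (∈-allFin a))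
  central-nbrs-complete c₁     _ (ℓ₂ _) ()
  central-nbrs-complete c₁     _ (x _)  ()
  central-nbrs-complete c₂     _ c₁     _  = here refl
  central-nbrs-complete c₂     _ c₂     ()
  central-nbrs-complete c₂     _ (ℓ₁ _) ()
  central-nbrs-complete c₂     _ (ℓ₂ a) _  = there (∈-map⁺ _ (∈-allFin a))
  central-nbrs-complete c₂     _ (x _)  ()
  central-nbrs-complete (ℓ₁ _) _ c₁     _  = here refl
  central-nbrs-complete (ℓ₁ _) _ c₂     ()
  central-nbrs-complete (ℓ₁ _) _ (ℓ₁ _) ()
  central-nbrs-complete (ℓ₁ _) _ (ℓ₂ _) ()
  central-nbrs-complete (ℓ₁ _) _ (x c)  _  = there (∈-map⁺ _ (∈-allFin c))
  central-nbrs-complete (ℓ₂ _) _ c₁     ()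
  central-nbrs-complete (ℓ₂ _) _ c₂     _  = here refl
  central-nbrs-complete (ℓ₂ _) _ (ℓ₁ _) ()
  central-nbrs-complete (ℓ₂ _) _ (ℓ₂ _) ()
  central-nbrs-complete (ℓ₂ _) _ (x c)  _  = there (∈-map⁺ _ (∈-allFin c))

  central-cover : ∀ v w → adjC v w ≡ true → Central v ⊎ Central w
  central-cover (x _) (x _)  ()
  central-cover (x _) c₁     _ = inj₂ tt
  central-cover (x _) c₂     _ = inj₂ tt
  central-cover (x _) (ℓ₁ _) _ = inj₂ tt
  central-cover (x _) (ℓ₂ _) _ = inj₂ tt
  central-cover c₁     _     _ = inj₁ tt
  central-cover c₂     _     _ = inj₁ tt
  central-cover (ℓ₁ _) _     _ = inj₁ tt
  central-cover (ℓ₂ _) _     _ = inj₁ tt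

  D : Fin (2 + (p + (p + p))) → Set
  D i = ∃ λ v → Central v × ⌜ v ⌝ ≡ i

  step : ∀ v w → Central v → adjC v w ≡ true → (G ─from D) ⌜ v ⌝ ⌜ w ⌝
  step v w cv v~w = adj⁺ v w v~w , v , cv , refl

  superMinimal : SuperMinimallyKConnected (suc p) G
  superMinimal = superMinimal-criterion (s≤s z≤n) connected D low cover ⌜ c₁ ⌝ walks dominated
    where
    low : ∀ {d} → D d → Σ (List (Fin _)) λ N → length N ≤ suc p × (∀ {y} → Adj G d y → y ∈ N)
    low (v , cv , refl) = map ⌜_⌝ (central-nbrs v cv) ,
      ≤-reflexive (trans (length-map ⌜_⌝ (central-nbrs v cv)) (length-central-nbrs v cv)) ,
      λ {y} → by-code {P = λ y → Adj G ⌜ v ⌝ y → y ∈ map ⌜_⌝ (central-nbrs v cv)}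
                (λ w v~w → ∈-map⁺ ⌜_⌝ (central-nbrs-complete v cv w (adj⁻ v~w))) y
    cover : ∀ {a b} → Adj G a b → D a ⊎ D b
    cover {a} {b} = by-code {P = λ a → Adj G a b → D a ⊎ D b} (λ v → by-code {P = λ b → Adj G ⌜ v ⌝ b → D ⌜ v ⌝ ⊎ D b}
      (λ w v~w → Sum.map (λ cv → v , cv , refl) (λ cw → w , cw , refl) (central-cover v w (adj⁻ v~w))) b) a
    walks : ∀ {d} → D d → Walk (G ─from D) d ⌜ c₁ ⌝ × Walk (G ─from D) ⌜ c₁ ⌝ d
    walks (c₁ , _ , refl)     = [ _ ] , [ _ ]
    walks (c₂ , _ , refl)     = _ ∷⟨ step c₂ c₁ tt refl ⟩ [ _ ] , _ ∷⟨ step c₁ c₂ tt refl ⟩ [ _ ]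
    walks (ℓ₁ a , _ , refl)   = _ ∷⟨ step (ℓ₁ a) c₁ tt refl ⟩ [ _ ] , _ ∷⟨ step c₁ (ℓ₁ a) tt refl ⟩ [ _ ]
    walks (ℓ₂ a , _ , refl)   = _ ∷⟨ step (ℓ₂ a) c₂ tt refl ⟩ _ ∷⟨ step c₂ c₁ tt refl ⟩ [ _ ] ,
                                _ ∷⟨ step c₁ c₂ tt refl ⟩ _ ∷⟨ step c₂ (ℓ₂ a) tt refl ⟩ [ _ ]
    dominated : ∀ y → D y ⊎ ∃ λ d → D d × Adj G d y
    dominated = by-code {P = λ y → D y ⊎ ∃ λ d → D d × Adj G d y} λ
      { c₁     → inj₁ (c₁ , tt , refl)
      ; c₂     → inj₁ (c₂ , tt , refl)
      ; (ℓ₁ a) → inj₁ (ℓ₁ a , tt , refl)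
      ; (ℓ₂ a) → inj₁ (ℓ₂ a , tt , refl)
      ; (x c)  → inj₂ (⌜ ℓ₁ zero ⌝ , (ℓ₁ zero , tt , refl) , adj⁺ (ℓ₁ zero) (x c) refl) }

lemma1p1 : ((k : ℕ) → 2 ≤ k → ∀ {n} (G : Graph n) →
    (UniformlyKConnected k G → SuperMinimallyKConnected k G) ×
    (SuperMinimallyKConnected k G → MinimallyKConnected k G)) ×
    ((k : ℕ) → 3 ≤ k →
    (∃ λ n → ∃ λ (G : Graph n) →
    SuperMinimallyKConnected k G × ¬ UniformlyKConnected k G) ×
    (∃ λ n → ∃ λ (G : Graph n) →
    MinimallyKConnected k G × ¬ SuperMinimallyKConnected k G))
lemma1p1 = (λ k 2≤k G → uniform⇒superMinimal 2≤k , superMinimal⇒minimal) , examples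
  where
  examples : (k : ℕ) → 3 ≤ k →
             (∃ λ n → ∃ λ (G : Graph n) → SuperMinimallyKConnected k G × ¬ UniformlyKConnected k G) ×
             (∃ λ n → ∃ λ (G : Graph n) → MinimallyKConnected k G × ¬ SuperMinimallyKConnected k G)
  examples k@(suc (suc (suc q))) (s≤s (s≤s (s≤s _))) =
    (_ , DoubleStar.G q , DoubleStar.superMinimal q , DoubleStar.not-uniform q) ,
    (_ , Bipartite.graph k (suc k) , K-minimal k (s≤s z≤n) , K-not-superMinimal k (s≤s z≤n))
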